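{- Each of the following graphs is word-representable: (i) for every $n\ge 2$, the cycle $G_n^1=C_{2n+1}$; (ii) for every $n\ge 2$, the graph $G_n^2$ with vertex set $\{1,2,\dots,2n+1,x,y\}$ and edge set consisting of the edges $\{i,i+1\}$ for $2\le i\le 2n$, the edges $\{1,i\}$ for all $2\le i\le 2n+1$, and the edges $\{2n+1,x\}$ and $\{2,y\}$; (iii) for every $n\ge 3$, the graph $G_n^3$ with vertex set $\{1,2,\dots,2n,x,y\}$ and edge set consisting of the edges $\{i,i+1\}$ for $2\le i\le 2n-2$, the edges $\{1,i\}$ and $\{2n,i\}$ for all $2\le i\le 2n-1$ (with $1$ and $2n$ non-adjacent), and the edges $\{1,x\}$, $\{2n-1,x\}$, $\{2,y\}$, $\{2n,y\}$.
   Context: All graphs are finite and simple. For a word $w$ over an alphabet and letters $i,j$, let $w_{ij}$ be the subsequence of $w$ consisting of all occurrences of $i$ and $j$; the letters $i$ and $j$ alternate in $w$ if $w_{ij}$ contains no factor $ii$ or $jj$. A graph $G$ is word-representable if there is a word $w$ over the alphabet $V(G)$ such that for all distinct $i,j\in V(G)$, $\{i,j\}\in E(G)$ if and only if $i$ and $j$ alternate in $w$. -}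

module Defs where

open import Data.Nat using (ℕ; zero; suc; _+_; _*_; _∸_; _≤_)
open import Data.Fin using (Fin; toℕ)
import Data.Fin.Properties as FinP
open import Data.List using (List; filter)
open import Data.List.Relation.Unary.Linked using (Linked)
open import Data.Product using (Σ; ∃; _×_; _,_)
open import Data.Sum using (_⊎_; inj₁; inj₂)
open import Data.Empty using (⊥)
open import Relation.Nullary using (¬_; yes; no)
open import Relation.Nullary.Decidable using (_⊎-dec_)
open import Relation.Binary.Definitions using (DecidableEquality)
open import Relation.Binary.PropositionalEquality using (_≡_; _≢_; refl; cong)
open import Function.Bundles using (_⇔_)

record Graph : Set₁ where
  field
    V       : Set
    _≟V_    : DecidableEquality V
    Edge    : V → V → Set
    sym     : ∀ {a b} → Edge a b → Edge b a
    irrefl  : ∀ {a} → ¬ Edge a a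

restrict : {V : Set} → DecidableEquality V → List V → V → V → List V
restrict _≟_ w i j = filter (λ c → (c ≟ i) ⊎-dec (c ≟ j)) w

-- i and j alternate in w iff w_ij contains no factor ii or jj, i.e. any
-- two consecutive letters of w_ij are different.
Alternate : {V : Set} → DecidableEquality V → List V → V → V → Set
Alternate _≟_ w i j = Linked _≢_ (restrict _≟_ w i j)

WordRepresentable : Graph → Set
WordRepresentable G =
  ∃ λ (w : List V) → ∀ (i j : V) → i ≢ j → (Edge i j ⇔ Alternate _≟V_ w i j)
  where open Graph G

SymClos : {V : Set} → (V → V → Set) → V → V → Set
SymClos B a b = B a b ⊎ B b a

SymClos-sym : {V : Set} (B : V → V → Set) → ∀ {a b} → SymClos B a b → SymClos B b a
SymClos-sym B (inj₁ p) = inj₂ p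
SymClos-sym B (inj₂ p) = inj₁ p

mkGraph : (V : Set) → DecidableEquality V → (V → V → Set) → Graph
mkGraph V dec B = record
  { V      = V
  ; _≟V_   = dec
  ; Edge   = λ a b → SymClos B a b × a ≢ b
  ; sym    = λ { (e , ne) → SymClos-sym B e , λ eq → ne (sym≡ eq) }
  ; irrefl = λ { (_ , ne) → ne refl }
  }
  where
    sym≡ : ∀ {a b : V} → a ≡ b → b ≡ a
    sym≡ refl = refl

lab : {m : ℕ} → Fin m → ℕ
lab i = suc (toℕ i)

CycleBase : (n : ℕ) → Fin (suc (2 * n)) → Fin (suc (2 * n)) → Set
CycleBase n i j = (lab j ≡ suc (lab i)) ⊎ (lab i ≡ suc (2 * n) × lab j ≡ 1)

G1 : ℕ → Graph
G1 n = mkGraph (Fin (suc (2 * n))) FinP._≟_ (CycleBase n)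

-- Vertex type {1,…,k} ∪ {x,y}: numbered vertex num i (i : Fin k) has
-- label toℕ i + 1.

data VXY (k : ℕ) : Set where
  num : Fin k → VXY k
  vx  : VXY k
  vy  : VXY k

VXY-≟ : (k : ℕ) → DecidableEquality (VXY k)
VXY-≟ k (num i) (num j) with FinP._≟_ i j
... | yes refl = yes refl
... | no ne    = no λ { refl → ne refl }
VXY-≟ k (num _) vx = no λ ()
VXY-≟ k (num _) vy = no λ ()
VXY-≟ k vx (num _) = no λ ()
VXY-≟ k vx vx = yes refl
VXY-≟ k vx vy = no λ ()
VXY-≟ k vy (num _) = no λ ()
VXY-≟ k vy vx = no λ ()
VXY-≟ k vy vy = yes refl

G2Base : (n : ℕ) → VXY (suc (2 * n)) → VXY (suc (2 * n)) → Set
G2Base n (num i) (num j) =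
  (2 ≤ lab i × lab i ≤ 2 * n × lab j ≡ suc (lab i))
  ⊎ (lab i ≡ 1 × 2 ≤ lab j × lab j ≤ suc (2 * n))
G2Base n (num i) vx = lab i ≡ suc (2 * n)
G2Base n (num i) vy = lab i ≡ 2
G2Base n _ _ = ⊥

G2 : ℕ → Graph
G2 n = mkGraph (VXY (suc (2 * n))) (VXY-≟ _) (G2Base n)

G3Base : (n : ℕ) → VXY (2 * n) → VXY (2 * n) → Set
G3Base n (num i) (num j) =
  (2 ≤ lab i × lab i ≤ 2 * n ∸ 2 × lab j ≡ suc (lab i))
  ⊎ (lab i ≡ 1 × 2 ≤ lab j × lab j ≤ 2 * n ∸ 1)
  ⊎ (lab i ≡ 2 * n × 2 ≤ lab j × lab j ≤ 2 * n ∸ 1)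
G3Base n (num i) vx = lab i ≡ 1 ⊎ lab i ≡ 2 * n ∸ 1
G3Base n (num i) vy = lab i ≡ 2 ⊎ lab i ≡ 2 * n
G3Base n _ _ = ⊥

G3 : ℕ → Graph
G3 n = mkGraph (VXY (2 * n)) (VXY-≟ _) (G3Base n)

module Submission where

open import Defs
open import Data.Nat using (ℕ; _≤_)
open import Data.Product using (_×_)

-- Every graph gets an explicit word over ℕ, transported to its vertices along an injective
-- coding.
--
-- Cycle 0 … m: the word 1 0 2 1 3 2 … m (m−1). An interior letter c occurs only in the
-- factor c (c−1) (c+1) c, so it alternates with its two neighbours and nothing else; the
-- endpoints 0 and m occur once each, so they alternate with each other.
--
-- Path 0 … 2p+1: the word rise p ++ (2p+1) ∷ fall p, with every letter but 0 occurring
-- twice. Going from p to p+1 replaces the middle letter m by (m+1) m (m+2) (m+1) (m+2):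
-- restrictions to old letters do not change, and the two new letters alternate with their
-- predecessor only.
--
-- Hubs: wrapping a block u of a word as h u h makes h alternate with every letter that occurs
-- once in u and at most once elsewhere, and with no letter missing from u. G_n^2 is the path
-- y, 2, …, 2n+1, x with the hub 1 wrapped around rise; G_n^3 is the path y, 2, …, 2n−1, x
-- with the hub 1 wrapped around rise ++ [x] and the hub 2n wrapped around fall.

open import Data.Nat using (zero; suc; _+_; _*_; _∸_; _<_; _≟_; _<?_; z≤n; s≤s; s<s⁻¹)
open import Data.Nat.Properties
open import Data.Fin using (Fin; toℕ; fromℕ<) renaming (zero to fzero; suc to fsuc)
import Data.Fin.Properties as Finₚ
open import Data.List using (List; []; _∷_; _++_; map)
open import Data.List.Properties
  using (filter-++; filter-accept; filter-reject; filter-none; filter-≐; ++-assoc; ++-identityʳ)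
open import Data.List.Relation.Unary.All as All using (All; []; _∷_)
import Data.List.Relation.Unary.All.Properties as Allₚ
open import Data.List.Relation.Unary.Linked as Linked using (Linked; []; [-]; _∷_)
import Data.List.Relation.Unary.Linked.Properties as Linkedₚ
open import Data.Product using (_,_; ∃-syntax; proj₁; proj₂; uncurry)
open import Data.Sum as Sum using (_⊎_; inj₁; inj₂; [_,_])
open import Data.Empty using (⊥-elim)
open import Function using (_∘_)
open import Function.Bundles using (_⇔_; mk⇔; Equivalence)
import Function.Properties.Equivalence as ⇔
open import Relation.Nullary using (¬_; yes; no)
open import Relation.Nullary.Decidable using (_⊎-dec_)
open import Relation.Unary using (Decidable)
open import Relation.Binary.Definitions using (DecidableEquality; tri<; tri≈; tri>)
open import Relation.Binary.PropositionalEquality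
  using (_≡_; _≢_; refl; sym; trans; cong; cong₂; subst; subst₂; module ≡-Reasoning)

module Restriction {A : Set} (_≟A_ : DecidableEquality A) where

  infix 5.5 _↾_,_
  _↾_,_ : List A → A → A → List A
  w ↾ a , b = restrict _≟A_ w a b

  private
    one-of? : ∀ a b → Decidable (λ c → c ≡ a ⊎ c ≡ b)
    one-of? a b c = (c ≟A a) ⊎-dec (c ≟A b)

  ↾-++ : ∀ u v {a b} → (u ++ v) ↾ a , b ≡ u ↾ a , b ++ v ↾ a , b
  ↾-++ u v {a} {b} = filter-++ (one-of? a b) u v

  ↾-keep : ∀ a b {c w} → c ≡ a ⊎ c ≡ b → (c ∷ w) ↾ a , b ≡ c ∷ w ↾ a , b
  ↾-keep a b = filter-accept (one-of? a b)

  ↾-keepˡ : ∀ a b {w} → (a ∷ w) ↾ a , b ≡ a ∷ w ↾ a , b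
  ↾-keepˡ a b = ↾-keep a b (inj₁ refl)

  ↾-keepʳ : ∀ a b {w} → (b ∷ w) ↾ a , b ≡ b ∷ w ↾ a , b
  ↾-keepʳ a b = ↾-keep a b (inj₂ refl)

  ↾-drop : ∀ a b {c w} → c ≢ a → c ≢ b → (c ∷ w) ↾ a , b ≡ w ↾ a , b
  ↾-drop a b c≢a c≢b = filter-reject (one-of? a b) [ c≢a , c≢b ]

  ↾-none : ∀ a b {w} → All (λ c → c ≢ a × c ≢ b) w → w ↾ a , b ≡ []
  ↾-none a b avoid = filter-none (one-of? a b) (All.map (λ (≢a , ≢b) → [ ≢a , ≢b ]) avoid)

  ↾-skip : ∀ a b u {v} → All (λ c → c ≢ a × c ≢ b) u → (u ++ v) ↾ a , b ≡ v ↾ a , b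
  ↾-skip a b u {v} avoid = trans (↾-++ u v) (cong (_++ v ↾ a , b) (↾-none a b avoid))

  ↾-∷ : ∀ a b x {u v} → u ↾ a , b ≡ v ↾ a , b → (x ∷ u) ↾ a , b ≡ (x ∷ v) ↾ a , b
  ↾-∷ a b x {u} {v} u≡v =
    trans (↾-++ (x ∷ []) u) (trans (cong ((x ∷ []) ↾ a , b ++_) u≡v) (sym (↾-++ (x ∷ []) v)))

  ↾-comm : ∀ w a b → w ↾ a , b ≡ w ↾ b , a
  ↾-comm w a b = filter-≐ (one-of? a b) (one-of? b a) (Sum.swap , Sum.swap) w

  ↾-map : ∀ {f : A → A} → (∀ {x y} → f x ≡ f y → x ≡ y) → ∀ w a b → map f w ↾ f a , f b ≡ map f (w ↾ a , b)
  ↾-map         f-inj []      a b = refl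
  ↾-map {f = f} f-inj (c ∷ w) a b with (c ≟A a) ⊎-dec (c ≟A b)
  ... | yes c∈ab = trans (↾-keep (f a) (f b) (Sum.map (cong f) (cong f) c∈ab))
                         (trans (cong (f c ∷_) (↾-map f-inj w a b)) (cong (map f) (sym (↾-keep a b c∈ab))))
  ... | no  c∉ab = trans (↾-drop (f a) (f b) (c∉ab ∘ inj₁ ∘ f-inj) (c∉ab ∘ inj₂ ∘ f-inj))
                         (trans (↾-map f-inj w a b) (cong (map f) (sym (↾-drop a b (c∉ab ∘ inj₁) (c∉ab ∘ inj₂)))))

  wrap : A → List A → List A
  wrap x u = x ∷ u ++ x ∷ []

  ↾-wrap-self : ∀ x c u → wrap x u ↾ x , c ≡ x ∷ u ↾ x , c ++ x ∷ []
  ↾-wrap-self x c u =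
    trans (↾-keepˡ x c) (cong (x ∷_) (trans (↾-++ u (x ∷ [])) (cong (u ↾ x , c ++_) (↾-keepˡ x c))))

  ↾-wrap-other : ∀ a b {x} u → x ≢ a → x ≢ b → wrap x u ↾ a , b ≡ u ↾ a , b
  ↾-wrap-other a b {x} u x≢a x≢b =
    trans (↾-drop a b x≢a x≢b)
      (trans (↾-++ u (x ∷ [])) (trans (cong (u ↾ a , b ++_) (↾-drop a b x≢a x≢b)) (++-identityʳ _)))

  alternate-sym : ∀ {w a b} → Alternate _≟A_ w a b → Alternate _≟A_ w b a
  alternate-sym {w} {a} {b} = subst (Linked _≢_) (↾-comm w a b)

  linked-++⁻ʳ : ∀ {R : A → A → Set} xs {ys} → Linked R (xs ++ ys) → Linked R ys
  linked-++⁻ʳ []           l = l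
  linked-++⁻ʳ (x ∷ [])     l = Linked.tail l
  linked-++⁻ʳ (x ∷ y ∷ xs) l = linked-++⁻ʳ (y ∷ xs) (Linked.tail l)

  ↾-repeat⇒¬alternate : ∀ w a b xs {x ys} → w ↾ a , b ≡ xs ++ x ∷ x ∷ ys → ¬ Alternate _≟A_ w a b
  ↾-repeat⇒¬alternate w a b xs w↾≡ alt = Linked.head (linked-++⁻ʳ xs (subst (Linked _≢_) w↾≡ alt)) refl

  repeat⇒¬alternate : ∀ u v {a b r} → v ↾ a , b ≡ a ∷ r → ¬ Alternate _≟A_ (u ++ a ∷ v) a b
  repeat⇒¬alternate u v {a} {b} {r} v↾≡ = ↾-repeat⇒¬alternate (u ++ a ∷ v) a b (u ↾ a , b) (begin
    (u ++ a ∷ v) ↾ a , b         ≡⟨ ↾-++ u (a ∷ v) ⟩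
    u ↾ a , b ++ (a ∷ v) ↾ a , b ≡⟨ cong (u ↾ a , b ++_) (trans (↾-keepˡ a b) (cong (a ∷_) v↾≡)) ⟩
    u ↾ a , b ++ a ∷ a ∷ r       ∎)
    where open ≡-Reasoning

  alternate-∷ : ∀ {w a b r} → b ≢ a → w ↾ a , b ≡ a ∷ r →
                Alternate _≟A_ w a b → Alternate _≟A_ (b ∷ w) a b
  alternate-∷ {w} {a} {b} b≢a w↾≡ alt =
    subst (Linked _≢_) (sym (↾-keepʳ a b))
      (subst (λ l → Linked _≢_ (b ∷ l)) (sym w↾≡) (b≢a ∷ subst (Linked _≢_) w↾≡ alt))

  alternate-∷⁻ : ∀ {x w a b} → Alternate _≟A_ (x ∷ w) a b → Alternate _≟A_ w a b
  alternate-∷⁻ {x} {w} {a} {b} alt =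
    linked-++⁻ʳ ((x ∷ []) ↾ a , b) (subst (Linked _≢_) (↾-++ (x ∷ []) w) alt)

open Restriction _≟_

↾-below : ∀ {t a b} w → All (_≤ t) w → t < a → t < b → w ↾ a , b ≡ []
↾-below {a = a} {b} w w≤t t<a t<b =
  ↾-none a b (All.map (λ x≤t → <⇒≢ (≤-<-trans x≤t t<a) , <⇒≢ (≤-<-trans x≤t t<b)) w≤t)

↾-above : ∀ {t a b} w → All (t ≤_) w → a < t → b < t → w ↾ a , b ≡ []
↾-above {a = a} {b} w t≤w a<t b<t =
  ↾-none a b (All.map (λ t≤x → >⇒≢ (<-≤-trans a<t t≤x) , >⇒≢ (<-≤-trans b<t t≤x)) t≤w)

both : ∀ {P Q : Set} → P → Q → P ⇔ Q
both p q = mk⇔ (λ _ → q) (λ _ → p)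

neither : ∀ {P Q : Set} → ¬ P → ¬ Q → P ⇔ Q
neither ¬p ¬q = mk⇔ (⊥-elim ∘ ¬p) (⊥-elim ∘ ¬q)

module _ {V : Set} (_≟V_ : DecidableEquality V) (code : V → ℕ) (vertex : ℕ → V)
         (vertex-code : ∀ v → vertex (code v) ≡ v) where

  private
    module V = Restriction _≟V_
    open ≡-Reasoning

    code-injective : ∀ {u v} → code u ≡ code v → u ≡ v
    code-injective {u} {v} eq = trans (sym (vertex-code u)) (trans (cong vertex eq) (vertex-code v))

  restrict-map-vertex : ∀ w → All (λ c → code (vertex c) ≡ c) w → ∀ u v →
                        map code (restrict _≟V_ (map vertex w) u v) ≡ w ↾ code u , code v
  restrict-map-vertex []      []          u v = refl
  restrict-map-vertex (c ∷ w) (c-ok ∷ ok) u v with (vertex c ≟V u) ⊎-dec (vertex c ≟V v)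
  ... | yes hit = begin
    map code (restrict _≟V_ (vertex c ∷ map vertex w) u v)        ≡⟨ cong (map code) (V.↾-keep u v hit) ⟩
    code (vertex c) ∷ map code (restrict _≟V_ (map vertex w) u v) ≡⟨ cong₂ _∷_ c-ok (restrict-map-vertex w ok u v) ⟩
    c ∷ w ↾ code u , code v                                       ≡⟨ ↾-keep (code u) (code v) (Sum.map coded coded hit) ⟨
    (c ∷ w) ↾ code u , code v                                     ∎
    where
      coded : ∀ {x} → vertex c ≡ x → c ≡ code x
      coded refl = sym c-ok
  ... | no miss = begin
    map code (restrict _≟V_ (vertex c ∷ map vertex w) u v) ≡⟨ cong (map code) (V.↾-drop u v (miss ∘ inj₁) (miss ∘ inj₂)) ⟩
    map code (restrict _≟V_ (map vertex w) u v)            ≡⟨ restrict-map-vertex w ok u v ⟩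
    w ↾ code u , code v                                    ≡⟨ c-dropped ⟨
    (c ∷ w) ↾ code u , code v                              ∎
    where
      decoded : ∀ {x} → c ≡ code x → vertex c ≡ x
      decoded refl = vertex-code _
      c-dropped : (c ∷ w) ↾ code u , code v ≡ w ↾ code u , code v
      c-dropped = ↾-drop (code u) (code v) (miss ∘ inj₁ ∘ decoded) (miss ∘ inj₂ ∘ decoded)

  alternate-map-vertex : ∀ w → All (λ c → code (vertex c) ≡ c) w → ∀ u v →
                         Alternate _≟V_ (map vertex w) u v ⇔ Alternate _≟_ w (code u) (code v)
  alternate-map-vertex w ok u v = mk⇔
    (subst (Linked _≢_) (restrict-map-vertex w ok u v) ∘ Linkedₚ.map⁺ ∘ Linked.map (λ u≢v → u≢v ∘ code-injective))
    (Linked.map (λ cu≢cv → cu≢cv ∘ cong code) ∘ Linkedₚ.map⁻ ∘ subst (Linked _≢_) (sym (restrict-map-vertex w ok u v)))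

module _ {V : Set} (B : V → V → Set) (code : V → ℕ) (w : List ℕ) where

  PairRepresented : V → V → Set
  PairRepresented u v = SymClos B u v ⇔ Alternate _≟_ w (code u) (code v)

  pairRepresented-sym : ∀ u v → PairRepresented u v → PairRepresented v u
  pairRepresented-sym u v r = mk⇔
    (alternate-sym {w} {code u} {code v} ∘ Equivalence.to r ∘ SymClos-sym B)
    (SymClos-sym B ∘ Equivalence.from r ∘ alternate-sym {w} {code v} {code u})

  pairRepresented-via-codes : ∀ u v {a b} → code u ≡ a → code v ≡ b →
                              SymClos B u v ⇔ Alternate _≟_ w a b → PairRepresented u v
  pairRepresented-via-codes u v refl refl r = r

  pairRepresented-by-order : ∀ {I : Set} (f : I → V) (key : I → ℕ) →
                             (∀ i j → key i < key j → PairRepresented (f i) (f j)) →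
                             ∀ i j → key i ≢ key j → PairRepresented (f i) (f j)
  pairRepresented-by-order f key ordered i j ki≢kj with <-cmp (key i) (key j)
  ... | tri< ki<kj _ _ = ordered i j ki<kj
  ... | tri≈ _ ki≡kj _ = ⊥-elim (ki≢kj ki≡kj)
  ... | tri> _ _ kj<ki = pairRepresented-sym (f j) (f i) (ordered j i kj<ki)

mkGraph-representable : ∀ {V} (_≟V_ : DecidableEquality V) (B : V → V → Set)
                        (code : V → ℕ) (vertex : ℕ → V) → (∀ v → vertex (code v) ≡ v) →
                        (w : List ℕ) → All (λ c → code (vertex c) ≡ c) w →
                        (∀ u v → u ≢ v → PairRepresented B code w u v) →
                        WordRepresentable (mkGraph V _≟V_ B)
mkGraph-representable _≟V_ B code vertex vertex-code w ok represented =
  map vertex w , λ u v u≢v →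
    ⇔.trans (mk⇔ proj₁ (_, u≢v))
      (⇔.trans (represented u v u≢v) (⇔.sym (alternate-map-vertex _≟V_ code vertex vertex-code w ok u v)))

zigzag : ℕ → List ℕ
zigzag zero    = []
zigzag (suc m) = zigzag m ++ suc m ∷ m ∷ []

zigzag-bounded : ∀ m → All (_≤ m) (zigzag m)
zigzag-bounded zero    = []
zigzag-bounded (suc m) = Allₚ.++⁺ (All.map m≤n⇒m≤1+n (zigzag-bounded m)) (≤-refl ∷ n≤1+n m ∷ [])

zigzag-extension : ∀ {m n} → m ≤ n → ∃[ v ] zigzag n ≡ zigzag m ++ v × All (m ≤_) v
zigzag-extension {n = zero} z≤n = [] , refl , []
zigzag-extension {m} {suc n} m≤1+n with m≤n⇒m<n∨m≡n m≤1+n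
... | inj₂ refl = [] , sym (++-identityʳ _) , []
... | inj₁ (s≤s m≤n) with zigzag-extension m≤n
...   | v , zigzag-n≡ , m≤v =
  v ++ suc n ∷ n ∷ [] ,
  trans (cong (_++ _) zigzag-n≡) (++-assoc (zigzag m) v _) ,
  Allₚ.++⁺ m≤v (m≤n⇒m≤1+n m≤n ∷ m≤n ∷ [])

zigzag-↾-truncate : ∀ {m n a b} → n ≤ m → a < n → b < n → zigzag m ↾ a , b ≡ zigzag n ↾ a , b
zigzag-↾-truncate {m} {n} {a} {b} n≤m a<n b<n with zigzag-extension n≤m
... | v , zigzag-m≡ , n≤v = begin
  zigzag m ↾ a , b              ≡⟨ cong (λ w → w ↾ a , b) zigzag-m≡ ⟩
  (zigzag n ++ v) ↾ a , b       ≡⟨ ↾-++ (zigzag n) v ⟩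
  zigzag n ↾ a , b ++ v ↾ a , b ≡⟨ cong (zigzag n ↾ a , b ++_) (↾-above v n≤v a<n b<n) ⟩
  zigzag n ↾ a , b ++ []        ≡⟨ ++-identityʳ _ ⟩
  zigzag n ↾ a , b              ∎
  where open ≡-Reasoning

zigzag-↾-last : ∀ c {b} → suc c < b → zigzag (suc c) ↾ suc c , b ≡ suc c ∷ []
zigzag-↾-last c {b} 1+c<b = begin
  zigzag (suc c) ↾ suc c , b                           ≡⟨ ↾-++ (zigzag c) _ ⟩
  zigzag c ↾ suc c , b ++ (suc c ∷ c ∷ []) ↾ suc c , b ≡⟨ cong₂ _++_ earlier (↾-keepˡ (suc c) b) ⟩
  suc c ∷ (c ∷ []) ↾ suc c , b                         ≡⟨ cong (suc c ∷_) (↾-drop (suc c) b (<⇒≢ (n<1+n c)) (<⇒≢ c<b)) ⟩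
  suc c ∷ []                                           ∎
  where
    open ≡-Reasoning
    c<b : c < b
    c<b = <-trans (n<1+n c) 1+c<b
    earlier : zigzag c ↾ suc c , b ≡ []
    earlier = ↾-below (zigzag c) (zigzag-bounded c) (n<1+n c) c<b

zigzag-↾-first : ∀ c {b} → suc c < b → zigzag (suc c) ↾ 0 , b ≡ 0 ∷ []
zigzag-↾-first zero    {suc (suc b)} _     = refl
zigzag-↾-first zero    {suc zero}    (s≤s ())
zigzag-↾-first (suc c) {b}           2+c<b = begin
  zigzag (2 + c) ↾ 0 , b                                 ≡⟨ ↾-++ (zigzag (suc c)) _ ⟩
  zigzag (suc c) ↾ 0 , b ++ (2 + c ∷ suc c ∷ []) ↾ 0 , b ≡⟨ cong₂ _++_ (zigzag-↾-first c 1+c<b) last-pair ⟩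
  0 ∷ []                                                 ∎
  where
    open ≡-Reasoning
    1+c<b : suc c < b
    1+c<b = <-trans (n<1+n _) 2+c<b
    last-pair : (2 + c ∷ suc c ∷ []) ↾ 0 , b ≡ []
    last-pair = ↾-none 0 b (((λ ()) , <⇒≢ 2+c<b) ∷ ((λ ()) , <⇒≢ 1+c<b) ∷ [])

zigzag-↾-top-pair : ∀ d → zigzag (2 + d) ↾ suc d , 2 + d ≡ suc d ∷ 2 + d ∷ suc d ∷ []
zigzag-↾-top-pair d = begin
  zigzag (2 + d) ↾ suc d , 2 + d                                         ≡⟨ ↾-++ (zigzag (suc d)) _ ⟩
  zigzag (suc d) ↾ suc d , 2 + d ++ (2 + d ∷ suc d ∷ []) ↾ suc d , 2 + d ≡⟨ cong₂ _++_ (zigzag-↾-last d ≤-refl) last-pair ⟩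
  suc d ∷ 2 + d ∷ suc d ∷ []                                             ∎
  where
    open ≡-Reasoning
    last-pair : (2 + d ∷ suc d ∷ []) ↾ suc d , 2 + d ≡ 2 + d ∷ suc d ∷ []
    last-pair = ↾-map (+-cancelʳ-≡ d _ _) (2 ∷ 1 ∷ []) 1 2

zigzag-adjacent : ∀ {m} c → c < m → Alternate _≟_ (zigzag m) c (suc c)
zigzag-adjacent {suc m} c c<1+m with m≤n⇒m<n∨m≡n (≤-pred c<1+m)
zigzag-adjacent {suc m} zero    _ | inj₂ refl = (λ ()) ∷ [-]
zigzag-adjacent {suc m} (suc d) _ | inj₂ refl =
  subst (Linked _≢_) (sym (zigzag-↾-top-pair d)) (1+n≢n ∘ sym ∷ 1+n≢n ∷ [-])
zigzag-adjacent {suc m} c _ | inj₁ c<m =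
  subst (Linked _≢_) (sym (zigzag-↾-truncate (s≤s c<m) (m≤n⇒m≤1+n (n<1+n c)) (n<1+n (suc c)))) (within c)
  where
    within : ∀ c → Alternate _≟_ (zigzag (2 + c)) c (suc c)
    within zero    = (λ ()) ∷ (λ ()) ∷ [-]
    within (suc d) = subst (Linked _≢_) (sym three-pairs) (1+n≢n ∘ sym ∷ 1+n≢n ∷ 1+n≢n ∘ sym ∷ [-])
      where
        open ≡-Reasoning
        last-pair : (3 + d ∷ 2 + d ∷ []) ↾ suc d , 2 + d ≡ 2 + d ∷ []
        last-pair = ↾-map (+-cancelʳ-≡ d _ _) (3 ∷ 2 ∷ []) 1 2
        three-pairs : zigzag (3 + d) ↾ suc d , 2 + d ≡ suc d ∷ 2 + d ∷ suc d ∷ 2 + d ∷ []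
        three-pairs = begin
          zigzag (3 + d) ↾ suc d , 2 + d                                         ≡⟨ ↾-++ (zigzag (2 + d)) _ ⟩
          zigzag (2 + d) ↾ suc d , 2 + d ++ (3 + d ∷ 2 + d ∷ []) ↾ suc d , 2 + d ≡⟨ cong₂ _++_ (zigzag-↾-top-pair d) last-pair ⟩
          suc d ∷ 2 + d ∷ suc d ∷ 2 + d ∷ []                                     ∎

zigzag-ends : ∀ m → 1 ≤ m → Alternate _≟_ (zigzag m) 0 m
zigzag-ends (suc zero)    _ = (λ ()) ∷ [-]
zigzag-ends (suc (suc e)) _ = subst (Linked _≢_) (sym ends) ((λ ()) ∷ [-])
  where
    open ≡-Reasoning
    last-pair : (2 + e ∷ suc e ∷ []) ↾ 0 , 2 + e ≡ 2 + e ∷ []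
    last-pair = trans (↾-keepʳ 0 (2 + e)) (cong (2 + e ∷_) (↾-drop 0 (2 + e) (λ ()) (<⇒≢ ≤-refl)))
    ends : zigzag (2 + e) ↾ 0 , 2 + e ≡ 0 ∷ 2 + e ∷ []
    ends = begin
      zigzag (2 + e) ↾ 0 , 2 + e                                     ≡⟨ ↾-++ (zigzag (suc e)) _ ⟩
      zigzag (suc e) ↾ 0 , 2 + e ++ (2 + e ∷ suc e ∷ []) ↾ 0 , 2 + e ≡⟨ cong₂ _++_ (zigzag-↾-first e ≤-refl) last-pair ⟩
      0 ∷ 2 + e ∷ []                                                 ∎

zigzag-repeat : ∀ {m d b} → 2 + d ≤ m → b ≢ d → b ≢ 2 + d → ¬ Alternate _≟_ (zigzag m) (suc d) b
zigzag-repeat {m} {d} {b} 2+d≤m b≢d b≢2+d with zigzag-extension 2+d≤m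
... | v , zigzag-m≡ , _ =
  repeat⇒¬alternate (zigzag d) (d ∷ 2 + d ∷ suc d ∷ v) neighbours-dropped ∘ subst (λ w → Alternate _≟_ w (suc d) b) split
  where
    open ≡-Reasoning
    split : zigzag m ≡ zigzag d ++ suc d ∷ d ∷ 2 + d ∷ suc d ∷ v
    split = begin
      zigzag m                                                   ≡⟨ zigzag-m≡ ⟩
      ((zigzag d ++ suc d ∷ d ∷ []) ++ 2 + d ∷ suc d ∷ []) ++ v ≡⟨ ++-assoc (zigzag d ++ _) _ v ⟩
      (zigzag d ++ suc d ∷ d ∷ []) ++ 2 + d ∷ suc d ∷ v         ≡⟨ ++-assoc (zigzag d) _ _ ⟩
      zigzag d ++ suc d ∷ d ∷ 2 + d ∷ suc d ∷ v                 ∎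
    neighbours-dropped : (d ∷ 2 + d ∷ suc d ∷ v) ↾ suc d , b ≡ suc d ∷ v ↾ suc d , b
    neighbours-dropped =
      trans (↾-skip (suc d) b (d ∷ 2 + d ∷ []) ((<⇒≢ ≤-refl , b≢d ∘ sym) ∷ (1+n≢n , b≢2+d ∘ sym) ∷ [])) (↾-keepˡ (suc d) b)

zigzag-alternate : ∀ {m} a b → a < b → b ≤ m → Alternate _≟_ (zigzag m) a b ⇔ (b ≡ suc a ⊎ (a ≡ 0 × b ≡ m))
zigzag-alternate a b a<b b≤m with b ≟ suc a
... | yes refl = both (zigzag-adjacent a b≤m) (inj₁ refl)
zigzag-alternate (suc d) b 1+d<b b≤m | no b≢2+d =
  neither (zigzag-repeat (≤-trans 1+d<b b≤m) (>⇒≢ (<-trans (n<1+n d) 1+d<b)) b≢2+d) [ b≢2+d , (λ ()) ∘ proj₁ ]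
zigzag-alternate {m} zero b 0<b b≤m | no b≢1 with b ≟ m
... | yes refl = both (zigzag-ends b 0<b) (inj₂ (refl , refl))
zigzag-alternate {m} zero (suc d) _ b≤m | no b≢1 | no b≢m =
  neither (zigzag-repeat (≤∧≢⇒< b≤m b≢m) (b≢1 ∘ cong suc ∘ sym) (λ ()) ∘ alternate-sym {zigzag m} {0})
          [ b≢1 , b≢m ∘ proj₂ ]

module _ (n : ℕ) where
  private
    N : ℕ
    N = suc (2 * n)

  cycleVertex : ℕ → Fin N
  cycleVertex c with c <? N
  ... | yes c<N = fromℕ< c<N
  ... | no _    = fzero

  cycleVertex-toℕ : ∀ i → cycleVertex (toℕ i) ≡ i
  cycleVertex-toℕ i with toℕ i <? N
  ... | yes i<N = Finₚ.fromℕ<-toℕ i i<N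
  ... | no i≮N  = ⊥-elim (i≮N (Finₚ.toℕ<n i))

  toℕ-cycleVertex : ∀ {c} → c ≤ 2 * n → toℕ (cycleVertex c) ≡ c
  toℕ-cycleVertex {c} c≤2n with c <? N
  ... | yes c<N = Finₚ.toℕ-fromℕ< c<N
  ... | no c≮N  = ⊥-elim (c≮N (s≤s c≤2n))

  cycle-edge : ∀ {i j : Fin N} → toℕ i < toℕ j →
               SymClos (CycleBase n) i j ⇔ (toℕ j ≡ suc (toℕ i) ⊎ (toℕ i ≡ 0 × toℕ j ≡ 2 * n))
  cycle-edge {i} {j} i<j = mk⇔ to from
    where
      to : SymClos (CycleBase n) i j → toℕ j ≡ suc (toℕ i) ⊎ (toℕ i ≡ 0 × toℕ j ≡ 2 * n)
      to (inj₁ (inj₁ j≡1+i))          = inj₁ (suc-injective j≡1+i)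
      to (inj₁ (inj₂ (_ , j≡0)))      = ⊥-elim (n≮0 (subst (toℕ i <_) (suc-injective j≡0) i<j))
      to (inj₂ (inj₁ i≡1+j))          = ⊥-elim (<-asym i<j (subst (toℕ j <_) (sym (suc-injective i≡1+j)) ≤-refl))
      to (inj₂ (inj₂ (j≡top , i≡0))) = inj₂ (suc-injective i≡0 , suc-injective j≡top)
      from : toℕ j ≡ suc (toℕ i) ⊎ (toℕ i ≡ 0 × toℕ j ≡ 2 * n) → SymClos (CycleBase n) i j
      from (inj₁ j≡1+i)         = inj₁ (inj₁ (cong suc j≡1+i))
      from (inj₂ (i≡0 , j≡top)) = inj₂ (inj₂ (cong suc j≡top , cong suc i≡0))

  cycle-ordered : ∀ i j → toℕ i < toℕ j → PairRepresented (CycleBase n) toℕ (zigzag (2 * n)) i j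
  cycle-ordered i j i<j =
    ⇔.trans (cycle-edge i<j) (⇔.sym (zigzag-alternate (toℕ i) (toℕ j) i<j (≤-pred (Finₚ.toℕ<n j))))

cycle-representable : ∀ n → WordRepresentable (G1 n)
cycle-representable n =
  mkGraph-representable Finₚ._≟_ (CycleBase n) toℕ (cycleVertex n) (cycleVertex-toℕ n) (zigzag (2 * n))
    (All.map (toℕ-cycleVertex n) (zigzag-bounded (2 * n)))
    (λ i j i≢j → pairRepresented-by-order (CycleBase n) toℕ (zigzag (2 * n)) (λ i → i) toℕ (cycle-ordered n) i j
                   (i≢j ∘ Finₚ.toℕ-injective))

-- top p = 2p + 1 (top≡), by a recursion that makes top (suc p) = 2 + top p definitional.
top : ℕ → ℕ
top zero    = 1
top (suc p) = 2 + top p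

top≡ : ∀ p → top p ≡ suc (2 * p)
top≡ zero    = refl
top≡ (suc p) = trans (cong (2 +_) (top≡ p)) (cong suc (sym (*-suc 2 p)))

-- rise p = 2 1 4 3 … 2p (2p−1)   and   fall p = 2p (2p+1) … 2 3 0 1.
rise : ℕ → List ℕ
rise zero    = []
rise (suc p) = rise p ++ suc (top p) ∷ top p ∷ []

fall : ℕ → List ℕ
fall zero    = 0 ∷ 1 ∷ []
fall (suc p) = suc (top p) ∷ 2 + top p ∷ fall p

pathWord : ℕ → List ℕ
pathWord p = rise p ++ top p ∷ fall p

top-positive : ∀ p → 1 ≤ top p
top-positive zero    = s≤s z≤n
top-positive (suc p) = s≤s z≤n

top≢1 : ∀ {p} → 1 ≤ p → top p ≢ 1
top≢1 {suc p} _ ()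

rise-bounded : ∀ p → All (λ c → 1 ≤ c × c < top p) (rise p)
rise-bounded zero    = []
rise-bounded (suc p) = Allₚ.++⁺ (All.map (λ (1≤c , c<t) → 1≤c , <-≤-trans c<t (m≤n+m _ 2)) (rise-bounded p))
  ((s≤s z≤n , ≤-refl) ∷ (top-positive p , m≤n+m _ 1) ∷ [])

rise-avoids : ∀ p {a b} → top p ≤ a → top p ≤ b → All (λ c → c ≢ a × c ≢ b) (rise p)
rise-avoids p t≤a t≤b = All.map (λ (_ , c<t) → <⇒≢ (<-≤-trans c<t t≤a) , <⇒≢ (<-≤-trans c<t t≤b)) (rise-bounded p)

fall-bounded : ∀ p → All (_≤ top p) (fall p)
fall-bounded zero    = z≤n ∷ ≤-refl ∷ []
fall-bounded (suc p) = n≤1+n _ ∷ ≤-refl ∷ All.map (λ c≤t → ≤-trans c≤t (m≤n+m _ 2)) (fall-bounded p)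

≤-2+-cases : ∀ {c t} → c ≤ 2 + t → c ≤ t ⊎ c ≡ suc t ⊎ c ≡ 2 + t
≤-2+-cases c≤2+t with m≤n⇒m<n∨m≡n c≤2+t
... | inj₂ c≡2+t = inj₂ (inj₂ c≡2+t)
... | inj₁ (s≤s c≤1+t) with m≤n⇒m<n∨m≡n c≤1+t
...   | inj₁ (s≤s c≤t) = inj₁ c≤t
...   | inj₂ c≡1+t     = inj₂ (inj₁ c≡1+t)

fall-once : ∀ p {a c} → top p < a → c ≤ top p → fall p ↾ a , c ≡ c ∷ []
fall-once zero    {suc (suc a)} _ z≤n       = refl
fall-once zero    {suc (suc a)} _ (s≤s z≤n) = refl
fall-once zero    {suc zero}    (s≤s ()) _
fall-once (suc p) {a} {c} 2+t<a c≤2+t with ≤-2+-cases c≤2+t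
... | inj₁ c≤t = begin
  (suc t ∷ 2 + t ∷ fall p) ↾ a , c ≡⟨ ↾-drop a c (<⇒≢ 1+t<a) (>⇒≢ (s≤s c≤t)) ⟩
  (2 + t ∷ fall p) ↾ a , c         ≡⟨ ↾-drop a c (<⇒≢ 2+t<a) (>⇒≢ (s≤s (m≤n⇒m≤1+n c≤t))) ⟩
  fall p ↾ a , c                   ≡⟨ fall-once p t<a c≤t ⟩
  c ∷ []                           ∎
  where
    t : ℕ
    t = top p
    t<a : t < a
    t<a = ≤-<-trans (m≤n+m t 2) 2+t<a
    1+t<a : suc t < a
    1+t<a = ≤-<-trans (n≤1+n _) 2+t<a
    open ≡-Reasoning
... | inj₂ (inj₁ refl) = begin
  (c ∷ 2 + t ∷ fall p) ↾ a , c ≡⟨ ↾-keepʳ a c ⟩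
  c ∷ (2 + t ∷ fall p) ↾ a , c ≡⟨ cong (c ∷_) (↾-drop a c (<⇒≢ 2+t<a) 1+n≢n) ⟩
  c ∷ fall p ↾ a , c           ≡⟨ cong (c ∷_) (↾-below (fall p) (fall-bounded p) (≤-<-trans (m≤n+m t 2) 2+t<a) ≤-refl) ⟩
  c ∷ []                       ∎
  where
    t : ℕ
    t = top p
    open ≡-Reasoning
... | inj₂ (inj₂ refl) = begin
  (suc t ∷ c ∷ fall p) ↾ a , c ≡⟨ ↾-drop a c (<⇒≢ (≤-<-trans (n≤1+n _) 2+t<a)) (<⇒≢ ≤-refl) ⟩
  (c ∷ fall p) ↾ a , c         ≡⟨ ↾-keepʳ a c ⟩
  c ∷ fall p ↾ a , c           ≡⟨ cong (c ∷_) (↾-below (fall p) (fall-bounded p) (≤-<-trans (m≤n+m t 2) 2+t<a) (n≤1+n (suc t))) ⟩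
  c ∷ []                       ∎
  where
    t : ℕ
    t = top p
    open ≡-Reasoning

<-2+-cases : ∀ {c t} → c < 2 + t → c < t ⊎ c ≡ t ⊎ c ≡ suc t
<-2+-cases c<2+t with ≤-2+-cases c<2+t
... | inj₁ c<t             = inj₁ c<t
... | inj₂ (inj₁ 1+c≡1+t)  = inj₂ (inj₁ (suc-injective 1+c≡1+t))
... | inj₂ (inj₂ 1+c≡2+t)  = inj₂ (inj₂ (suc-injective 1+c≡2+t))

rise-once : ∀ p {a c} → top p ≤ a → 1 ≤ c → c < top p → rise p ↾ a , c ≡ c ∷ []
rise-once zero    _ (s≤s z≤n) (s≤s ())
rise-once (suc p) {a} {c} 2+t≤a 1≤c c<2+t = begin
  rise (suc p) ↾ a , c                          ≡⟨ ↾-++ (rise p) _ ⟩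
  rise p ↾ a , c ++ (suc t ∷ t ∷ []) ↾ a , c    ≡⟨ split (<-2+-cases c<2+t) ⟩
  c ∷ []                                        ∎
  where
    t : ℕ
    t = top p
    open ≡-Reasoning
    t<a : t < a
    t<a = <-≤-trans (n<1+n t) (≤-trans (n≤1+n _) 2+t≤a)
    1+t<a : suc t < a
    1+t<a = <-≤-trans (n<1+n (suc t)) 2+t≤a
    rise-misses : ∀ {b} → t ≤ b → rise p ↾ a , b ≡ []
    rise-misses t≤b = ↾-none a _ (rise-avoids p (<⇒≤ t<a) t≤b)
    split : c < t ⊎ c ≡ t ⊎ c ≡ suc t → rise p ↾ a , c ++ (suc t ∷ t ∷ []) ↾ a , c ≡ c ∷ []
    split (inj₁ c<t) = cong₂ _++_ (rise-once p (≤-trans (n≤1+n _) (≤-trans (n≤1+n _) 2+t≤a)) 1≤c c<t)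
                                  (↾-none a c ((<⇒≢ 1+t<a , >⇒≢ (<-trans c<t (n<1+n t))) ∷ (<⇒≢ t<a , >⇒≢ c<t) ∷ []))
    split (inj₂ (inj₁ refl)) = cong₂ _++_ (rise-misses ≤-refl) (trans (↾-drop a c (<⇒≢ 1+t<a) 1+n≢n) (↾-keepʳ a c))
    split (inj₂ (inj₂ refl)) =
      cong₂ _++_ (rise-misses (n≤1+n t)) (trans (↾-keepʳ a c) (cong (c ∷_) (↾-drop a c (<⇒≢ t<a) (<⇒≢ (n<1+n t)))))

module _ (p : ℕ) where
  private
    t : ℕ
    t = top p
    open ≡-Reasoning

    middle : List ℕ
    middle = map (_+ t) (1 ∷ 0 ∷ 2 ∷ 1 ∷ 2 ∷ [])

    pathWord-suc : pathWord (suc p) ≡ rise p ++ middle ++ fall p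
    pathWord-suc = ++-assoc (rise p) _ _

    middle-↾ : ∀ a b → middle ↾ a + t , b + t ≡ map (_+ t) ((1 ∷ 0 ∷ 2 ∷ 1 ∷ 2 ∷ []) ↾ a , b)
    middle-↾ = ↾-map (+-cancelʳ-≡ t _ _) (1 ∷ 0 ∷ 2 ∷ 1 ∷ 2 ∷ [])

    pathWord-suc-↾ : ∀ {a b} → All (λ c → c ≢ a × c ≢ b) (rise p) →
                     pathWord (suc p) ↾ a , b ≡ middle ↾ a , b ++ fall p ↾ a , b
    pathWord-suc-↾ {a} {b} avoid = begin
      pathWord (suc p) ↾ a , b           ≡⟨ cong (λ w → w ↾ a , b) pathWord-suc ⟩
      (rise p ++ middle ++ fall p) ↾ a , b ≡⟨ ↾-skip a b (rise p) avoid ⟩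
      (middle ++ fall p) ↾ a , b         ≡⟨ ↾-++ middle (fall p) ⟩
      middle ↾ a , b ++ fall p ↾ a , b   ∎

  pathWord-↾-old : ∀ {a b} → a < b → b ≤ t → pathWord (suc p) ↾ a , b ≡ pathWord p ↾ a , b
  pathWord-↾-old {a} {b} a<b b≤t = begin
    pathWord (suc p) ↾ a , b                         ≡⟨ cong (λ w → w ↾ a , b) pathWord-suc ⟩
    (rise p ++ middle ++ fall p) ↾ a , b             ≡⟨ ↾-++ (rise p) (middle ++ fall p) ⟩
    rise p ↾ a , b ++ (middle ++ fall p) ↾ a , b     ≡⟨ cong (rise p ↾ a , b ++_) new-letters-dropped ⟩
    rise p ↾ a , b ++ (t ∷ fall p) ↾ a , b           ≡⟨ ↾-++ (rise p) (t ∷ fall p) ⟨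
    pathWord p ↾ a , b                               ∎
    where
      new≢ : ∀ {x} → t < x → x ≢ a × x ≢ b
      new≢ t<x = >⇒≢ (<-trans a<b (≤-<-trans b≤t t<x)) , >⇒≢ (≤-<-trans b≤t t<x)
      new-letters-dropped : (middle ++ fall p) ↾ a , b ≡ (t ∷ fall p) ↾ a , b
      new-letters-dropped =
        trans (uncurry (↾-drop a b) (new≢ ≤-refl))
              (↾-∷ a b t (↾-skip a b (2 + t ∷ suc t ∷ 2 + t ∷ []) (new≢ (n≤1+n _) ∷ new≢ ≤-refl ∷ new≢ (n≤1+n _) ∷ [])))

  pathWord-↾-lower-edge : pathWord (suc p) ↾ t , suc t ≡ suc t ∷ t ∷ suc t ∷ t ∷ []
  pathWord-↾-lower-edge =
    trans (pathWord-suc-↾ (rise-avoids p ≤-refl (n≤1+n t)))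
          (cong₂ _++_ (middle-↾ 0 1) (trans (↾-comm (fall p) t (suc t)) (fall-once p ≤-refl ≤-refl)))

  pathWord-↾-upper-edge : pathWord (suc p) ↾ suc t , 2 + t ≡ suc t ∷ 2 + t ∷ suc t ∷ 2 + t ∷ []
  pathWord-↾-upper-edge =
    trans (pathWord-suc-↾ (rise-avoids p (n≤1+n t) (m≤n+m t 2)))
          (cong₂ _++_ (middle-↾ 1 2) (↾-below (fall p) (fall-bounded p) (n<1+n t) (n≤1+n (suc t))))

  pathWord-lower-repeat : ∀ {a} → a < t → ¬ Alternate _≟_ (pathWord (suc p)) a (suc t)
  pathWord-lower-repeat {a} a<t =
    repeat⇒¬alternate (rise p) (t ∷ 2 + t ∷ suc t ∷ 2 + t ∷ fall p) neighbours-dropped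
      ∘ subst (λ w → Alternate _≟_ w (suc t) a) pathWord-suc ∘ alternate-sym {pathWord (suc p)} {a}
    where
      neighbours-dropped : (t ∷ 2 + t ∷ suc t ∷ 2 + t ∷ fall p) ↾ suc t , a ≡ suc t ∷ (2 + t ∷ fall p) ↾ suc t , a
      neighbours-dropped =
        trans (↾-skip (suc t) a (t ∷ 2 + t ∷ [])
                      ((<⇒≢ (n<1+n t) , >⇒≢ a<t) ∷ (1+n≢n , >⇒≢ (<-trans a<t (n≤1+n (suc t)))) ∷ []))
              (↾-keepˡ (suc t) a)

  pathWord-upper-repeat : ∀ {a} → a ≤ t → ¬ Alternate _≟_ (pathWord (suc p)) a (2 + t)
  pathWord-upper-repeat {a} a≤t =
    repeat⇒¬alternate (rise (suc p)) (suc t ∷ 2 + t ∷ fall p) neighbour-dropped ∘ alternate-sym {pathWord (suc p)} {a}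
    where
      neighbour-dropped : (suc t ∷ 2 + t ∷ fall p) ↾ 2 + t , a ≡ 2 + t ∷ fall p ↾ 2 + t , a
      neighbour-dropped = trans (↾-drop (2 + t) a (<⇒≢ ≤-refl) (>⇒≢ (s≤s a≤t))) (↾-keepˡ (2 + t) a)

pathWord-alternate : ∀ p {a b} → a < b → b ≤ top p → Alternate _≟_ (pathWord p) a b ⇔ b ≡ suc a
pathWord-alternate zero {zero} {suc zero} _ _ = both ((λ ()) ∷ (λ ()) ∷ [-]) refl
pathWord-alternate zero {suc a} {suc zero} (s≤s ()) _
pathWord-alternate zero {b = suc (suc b)} _ (s≤s ())
pathWord-alternate (suc p) {a} {b} a<b b≤2+t with ≤-2+-cases b≤2+t
... | inj₁ b≤t =
  ⇔.trans (mk⇔ (subst (Linked _≢_) old) (subst (Linked _≢_) (sym old))) (pathWord-alternate p a<b b≤t)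
  where
    old : pathWord (suc p) ↾ a , b ≡ pathWord p ↾ a , b
    old = pathWord-↾-old p a<b b≤t
... | inj₂ (inj₁ refl) with m≤n⇒m<n∨m≡n (≤-pred a<b)
...   | inj₂ refl = both (subst (Linked _≢_) (sym (pathWord-↾-lower-edge p)) (1+n≢n ∷ 1+n≢n ∘ sym ∷ 1+n≢n ∷ [-])) refl
...   | inj₁ a<t  = neither (pathWord-lower-repeat p a<t) (<⇒≢ a<t ∘ suc-injective ∘ sym)
pathWord-alternate (suc p) {a} {b} a<b b≤2+t | inj₂ (inj₂ refl) with m≤n⇒m<n∨m≡n (≤-pred a<b)
...   | inj₂ refl = both (subst (Linked _≢_) (sym (pathWord-↾-upper-edge p)) (1+n≢n ∘ sym ∷ 1+n≢n ∷ 1+n≢n ∘ sym ∷ [-])) refl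
...   | inj₁ a≤t  = neither (pathWord-upper-repeat p (≤-pred a≤t)) (<⇒≢ a≤t ∘ suc-injective ∘ sym)

fanWord : ℕ → List ℕ
fanWord p = wrap (suc (top p)) (rise p) ++ top p ∷ fall p

module _ (p : ℕ) where
  private
    t : ℕ
    t = top p
    h : ℕ
    h = suc (top p)
    open ≡-Reasoning

    fanWord-↾-hub : ∀ c → fanWord p ↾ h , c ≡ (h ∷ rise p ↾ h , c ++ h ∷ []) ++ (t ∷ fall p) ↾ h , c
    fanWord-↾-hub c =
      trans (↾-++ (wrap h (rise p)) (t ∷ fall p)) (cong (_++ (t ∷ fall p) ↾ h , c) (↾-wrap-self h c (rise p)))

  fanWord-alternate-path : ∀ {a b} → a < b → b ≤ t → Alternate _≟_ (fanWord p) a b ⇔ b ≡ suc a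
  fanWord-alternate-path {a} {b} a<b b≤t =
    ⇔.trans (mk⇔ (subst (Linked _≢_) hub-erased) (subst (Linked _≢_) (sym hub-erased))) (pathWord-alternate p a<b b≤t)
    where
      hub-erased : fanWord p ↾ a , b ≡ pathWord p ↾ a , b
      hub-erased = begin
        (wrap h (rise p) ++ t ∷ fall p) ↾ a , b         ≡⟨ ↾-++ (wrap h (rise p)) (t ∷ fall p) ⟩
        wrap h (rise p) ↾ a , b ++ (t ∷ fall p) ↾ a , b ≡⟨ cong (_++ (t ∷ fall p) ↾ a , b) (↾-wrap-other a b (rise p) h≢a h≢b) ⟩
        rise p ↾ a , b ++ (t ∷ fall p) ↾ a , b          ≡⟨ ↾-++ (rise p) (t ∷ fall p) ⟨
        pathWord p ↾ a , b                              ∎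
        where
          h≢a : h ≢ a
          h≢a = >⇒≢ (<-≤-trans a<b (m≤n⇒m≤1+n b≤t))
          h≢b : h ≢ b
          h≢b = >⇒≢ (s≤s b≤t)

  fanWord-alternate-hub : ∀ {c} → 1 ≤ c → c < t → Alternate _≟_ (fanWord p) h c
  fanWord-alternate-hub {c} 1≤c c<t = subst (Linked _≢_) (sym hub-↾) (>⇒≢ c<h ∷ <⇒≢ c<h ∷ >⇒≢ c<h ∷ [-])
    where
      c<h : c < h
      c<h = <-trans c<t (n<1+n t)
      top-and-fall : (t ∷ fall p) ↾ h , c ≡ c ∷ []
      top-and-fall = trans (↾-drop h c (<⇒≢ (n<1+n t)) (>⇒≢ c<t)) (fall-once p (n<1+n t) (<⇒≤ c<t))
      hub-↾ : fanWord p ↾ h , c ≡ h ∷ c ∷ h ∷ c ∷ []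
      hub-↾ = begin
        fanWord p ↾ h , c                                       ≡⟨ fanWord-↾-hub c ⟩
        (h ∷ rise p ↾ h , c ++ h ∷ []) ++ (t ∷ fall p) ↾ h , c  ≡⟨ cong₂ (λ r s → (h ∷ r ++ h ∷ []) ++ s)
                                                                         (rise-once p (n≤1+n t) 1≤c c<t) top-and-fall ⟩
        h ∷ c ∷ h ∷ c ∷ []                                      ∎

  fanWord-¬alternate-hub : ∀ {c} → c ≡ 0 ⊎ c ≡ t → ¬ Alternate _≟_ (fanWord p) h c
  fanWord-¬alternate-hub {c} c-end =
    ↾-repeat⇒¬alternate (fanWord p) h c []
      (trans (fanWord-↾-hub c) (cong (λ r → (h ∷ r ++ h ∷ []) ++ (t ∷ fall p) ↾ h , c) rise-misses))
    where
      outside : ∀ {x} → c ≡ 0 ⊎ c ≡ t → 1 ≤ x → x < t → x ≢ c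
      outside (inj₁ refl) 1≤x _   = >⇒≢ 1≤x
      outside (inj₂ refl) _   x<t = <⇒≢ x<t
      rise-misses : rise p ↾ h , c ≡ []
      rise-misses = ↾-none h c (All.map (λ (1≤x , x<t) → <⇒≢ (<-trans x<t (n<1+n t)) , outside c-end 1≤x x<t) (rise-bounded p))

fanWord-bounded : ∀ p → All (_≤ suc (top p)) (fanWord p)
fanWord-bounded p =
  ≤-refl ∷ Allₚ.++⁺ (Allₚ.++⁺ (All.map (λ (_ , x<t) → m≤n⇒m≤1+n (<⇒≤ x<t)) (rise-bounded p)) (≤-refl ∷ []))
                    (n≤1+n _ ∷ All.map m≤n⇒m≤1+n (fall-bounded p))

-- The vertex y is coded 0, the vertex labelled ℓ ∈ [2, 2n+1] is coded ℓ − 1, x is coded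
-- 2n+1 = top n and the hub 1 is coded 2n+2: the path y, 2, …, 2n+1, x becomes 0 … top n.
module _ (n : ℕ) where
  private
    t : ℕ
    t = top n
    N : ℕ
    N = suc (2 * n)

  fanCode : VXY N → ℕ
  fanCode (num fzero)    = suc t
  fanCode (num (fsuc i)) = suc (toℕ i)
  fanCode vx             = t
  fanCode vy             = 0

  fanVertex : ℕ → VXY N
  fanVertex zero = vy
  fanVertex (suc c) with <-cmp c (2 * n)
  ... | tri< c<2n _ _ = num (fsuc (fromℕ< c<2n))
  ... | tri≈ _ _ _    = vx
  ... | tri> _ _ _    = num fzero

  fanVertex-code : ∀ v → fanVertex (fanCode v) ≡ v
  fanVertex-code (num fzero) rewrite top≡ n with <-cmp (suc (2 * n)) (2 * n)
  ... | tri< 1+2n<2n _ _ = ⊥-elim (<-asym 1+2n<2n (n<1+n _))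
  ... | tri≈ _ 1+2n≡2n _ = ⊥-elim (1+n≢n 1+2n≡2n)
  ... | tri> _ _ _       = refl
  fanVertex-code (num (fsuc i)) with <-cmp (toℕ i) (2 * n)
  ... | tri< i<2n _ _ = cong (num ∘ fsuc) (Finₚ.fromℕ<-toℕ i i<2n)
  ... | tri≈ i≮2n _ _ = ⊥-elim (i≮2n (Finₚ.toℕ<n i))
  ... | tri> i≮2n _ _ = ⊥-elim (i≮2n (Finₚ.toℕ<n i))
  fanVertex-code vx rewrite top≡ n with <-cmp (2 * n) (2 * n)
  ... | tri< 2n<2n _ _ = ⊥-elim (<-irrefl refl 2n<2n)
  ... | tri≈ _ _ _     = refl
  ... | tri> _ _ 2n<2n = ⊥-elim (<-irrefl refl 2n<2n)
  fanVertex-code vy = refl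

  fanCode-vertex : ∀ {c} → c ≤ suc t → fanCode (fanVertex c) ≡ c
  fanCode-vertex {zero}  _ = refl
  fanCode-vertex {suc c} 1+c≤1+t with <-cmp c (2 * n)
  ... | tri< c<2n _ _ = cong suc (Finₚ.toℕ-fromℕ< c<2n)
  ... | tri≈ _ refl _ = top≡ n
  ... | tri> _ _ 2n<c = trans (cong suc (top≡ n)) (cong suc (≤-antisym 2n<c (subst (c ≤_) (top≡ n) (≤-pred 1+c≤1+t))))

module _ (n : ℕ) (1≤n : 1 ≤ n) where
  private
    t : ℕ
    t = top n
    w : List ℕ
    w = fanWord n
    PR : VXY (suc (2 * n)) → VXY (suc (2 * n)) → Set
    PR = PairRepresented (G2Base n) (fanCode n) w
    PR-sym : ∀ u v → PR u v → PR v u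
    PR-sym = pairRepresented-sym (G2Base n) (fanCode n) w

    path-code< : ∀ (i : Fin (2 * n)) → suc (toℕ i) < t
    path-code< i = subst (suc (toℕ i) <_) (sym (top≡ n)) (s≤s (Finₚ.toℕ<n i))

    hub-path : ∀ j → PR (num fzero) (num (fsuc j))
    hub-path j = both (inj₁ (inj₂ (refl , s≤s (s≤s z≤n) , s≤s (Finₚ.toℕ<n j))))
                      (fanWord-alternate-hub n (s≤s z≤n) (path-code< j))

    hub-x : PR (num fzero) vx
    hub-x = neither (λ { (inj₁ 1≡1+2n) → top≢1 1≤n (trans (top≡ n) (sym 1≡1+2n)) ; (inj₂ ()) })
                        (fanWord-¬alternate-hub n (inj₂ refl))

    hub-y : PR (num fzero) vy
    hub-y = neither (λ { (inj₁ ()) ; (inj₂ ()) }) (fanWord-¬alternate-hub n (inj₁ refl))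

    path-path : ∀ i j → toℕ i < toℕ j → PR (num (fsuc i)) (num (fsuc j))
    path-path i j i<j = ⇔.trans (mk⇔ to from) (⇔.sym (fanWord-alternate-path n (s≤s i<j) (<⇒≤ (path-code< j))))
      where
        to : SymClos (G2Base n) (num (fsuc i)) (num (fsuc j)) → suc (toℕ j) ≡ suc (suc (toℕ i))
        to (inj₁ (inj₁ (_ , _ , j≡1+i))) = suc-injective j≡1+i
        to (inj₁ (inj₂ (() , _)))
        to (inj₂ (inj₁ (_ , _ , i≡1+j))) =
          ⊥-elim (<-asym i<j (subst (toℕ j <_) (sym (suc-injective (suc-injective i≡1+j))) (n<1+n _)))
        to (inj₂ (inj₂ (() , _)))
        from : suc (toℕ j) ≡ suc (suc (toℕ i)) → SymClos (G2Base n) (num (fsuc i)) (num (fsuc j))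
        from j≡1+i = inj₁ (inj₁ (s≤s (s≤s z≤n) , subst (_≤ 2 * n) j≡1+i (Finₚ.toℕ<n j) , cong suc j≡1+i))

    path-x : ∀ i → PR (num (fsuc i)) vx
    path-x i = ⇔.trans (mk⇔ to from) (⇔.sym (fanWord-alternate-path n (path-code< i) ≤-refl))
      where
        to : SymClos (G2Base n) (num (fsuc i)) vx → t ≡ suc (suc (toℕ i))
        to (inj₁ i≡2n) = trans (top≡ n) (sym i≡2n)
        to (inj₂ ())
        from : t ≡ suc (suc (toℕ i)) → SymClos (G2Base n) (num (fsuc i)) vx
        from t≡2+i = inj₁ (trans (sym t≡2+i) (top≡ n))

    y-path : ∀ j → PR vy (num (fsuc j))
    y-path j = ⇔.trans (mk⇔ to from) (⇔.sym (fanWord-alternate-path n (s≤s z≤n) (<⇒≤ (path-code< j))))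
      where
        to : SymClos (G2Base n) vy (num (fsuc j)) → suc (toℕ j) ≡ 1
        to (inj₁ ())
        to (inj₂ j≡0) = suc-injective j≡0
        from : suc (toℕ j) ≡ 1 → SymClos (G2Base n) vy (num (fsuc j))
        from j≡0 = inj₂ (cong suc j≡0)

    y-x : PR vy vx
    y-x = neither (λ { (inj₁ ()) ; (inj₂ ()) }) (top≢1 1≤n ∘ Equivalence.to (fanWord-alternate-path n (top-positive n) ≤-refl))

  fan-pairs : ∀ u v → u ≢ v → PR u v
  fan-pairs (num fzero)    (num fzero)    u≢v = ⊥-elim (u≢v refl)
  fan-pairs (num fzero)    (num (fsuc j)) _   = hub-path j
  fan-pairs (num fzero)    vx             _   = hub-x
  fan-pairs (num fzero)    vy             _   = hub-y
  fan-pairs (num (fsuc i)) (num fzero)    _   = PR-sym (num fzero) (num (fsuc i)) (hub-path i)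
  fan-pairs (num (fsuc i)) (num (fsuc j)) u≢v =
    pairRepresented-by-order (G2Base n) (fanCode n) w (num ∘ fsuc) toℕ path-path i j (u≢v ∘ cong (num ∘ fsuc) ∘ Finₚ.toℕ-injective)
  fan-pairs (num (fsuc i)) vx             _   = path-x i
  fan-pairs (num (fsuc i)) vy             _   = PR-sym vy (num (fsuc i)) (y-path i)
  fan-pairs vx             (num fzero)    _   = PR-sym (num fzero) vx hub-x
  fan-pairs vx             (num (fsuc j)) _   = PR-sym (num (fsuc j)) vx (path-x j)
  fan-pairs vx             vx             u≢v = ⊥-elim (u≢v refl)
  fan-pairs vx             vy             _   = PR-sym vy vx y-x
  fan-pairs vy             (num fzero)    _   = PR-sym (num fzero) vy hub-y
  fan-pairs vy             (num (fsuc j)) _   = y-path j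
  fan-pairs vy             vx             _   = y-x
  fan-pairs vy             vy             u≢v = ⊥-elim (u≢v refl)

fan-representable : ∀ n → 1 ≤ n → WordRepresentable (G2 n)
fan-representable n 1≤n =
  mkGraph-representable (VXY-≟ _) (G2Base n) (fanCode n) (fanVertex n) (fanVertex-code n) (fanWord n)
    (All.map (fanCode-vertex n) (fanWord-bounded n)) (fan-pairs n 1≤n)

-- The leading copy of top p keeps that letter from alternating with the second hub.
doubleFanWord : ℕ → List ℕ
doubleFanWord p = top p ∷ wrap (suc (top p)) (rise p ++ top p ∷ []) ++ wrap (2 + top p) (fall p)

module _ (p : ℕ) where
  private
    t : ℕ
    t = top p
    h₁ h₂ : ℕ
    h₁ = suc (top p)
    h₂ = 2 + top p
    front core : List ℕ
    front = rise p ++ t ∷ []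
    core = wrap h₁ front ++ wrap h₂ (fall p)
    open ≡-Reasoning

    t<h₁ : t < h₁
    t<h₁ = n<1+n t

    t<h₂ : t < h₂
    t<h₂ = n≤1+n (suc t)

    front-bounded : All (λ c → 1 ≤ c × c ≤ t) front
    front-bounded = Allₚ.++⁺ (All.map (λ (1≤c , c<t) → 1≤c , <⇒≤ c<t) (rise-bounded p)) ((top-positive p , ≤-refl) ∷ [])

    front-misses-0 : ∀ {a} → t < a → front ↾ a , 0 ≡ []
    front-misses-0 {a} t<a = ↾-none a 0 (All.map (λ (1≤c , c≤t) → <⇒≢ (≤-<-trans c≤t t<a) , >⇒≢ 1≤c) front-bounded)

    front-once : ∀ {a c} → t < a → 1 ≤ c → c ≤ t → front ↾ a , c ≡ c ∷ []
    front-once {a} {c} t<a 1≤c c≤t with m≤n⇒m<n∨m≡n c≤t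
    ... | inj₁ c<t = begin
      (rise p ++ t ∷ []) ↾ a , c         ≡⟨ ↾-++ (rise p) (t ∷ []) ⟩
      rise p ↾ a , c ++ (t ∷ []) ↾ a , c ≡⟨ cong₂ _++_ (rise-once p (<⇒≤ t<a) 1≤c c<t) (↾-drop a c (<⇒≢ t<a) (>⇒≢ c<t)) ⟩
      c ∷ []                             ∎
    ... | inj₂ refl = trans (↾-skip a t (rise p) (rise-avoids p (<⇒≤ t<a) ≤-refl)) (↾-keepʳ a t)

    core-↾-path : ∀ {a b} → a ≤ t → b ≤ t → core ↾ a , b ≡ pathWord p ↾ a , b
    core-↾-path {a} {b} a≤t b≤t = begin
      core ↾ a , b                                       ≡⟨ ↾-++ (wrap h₁ front) (wrap h₂ (fall p)) {a} {b} ⟩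
      wrap h₁ front ↾ a , b ++ wrap h₂ (fall p) ↾ a , b ≡⟨ cong₂ _++_ (↾-wrap-other a b front (h₁≢ a≤t) (h₁≢ b≤t))
                                                                       (↾-wrap-other a b (fall p) (h₂≢ a≤t) (h₂≢ b≤t)) ⟩
      front ↾ a , b ++ fall p ↾ a , b                    ≡⟨ ↾-++ front (fall p) ⟨
      (front ++ fall p) ↾ a , b                          ≡⟨ cong (λ w → w ↾ a , b) (++-assoc (rise p) (t ∷ []) (fall p)) ⟩
      pathWord p ↾ a , b                                 ∎
      where
        h₁≢ : ∀ {x} → x ≤ t → h₁ ≢ x
        h₁≢ x≤t = >⇒≢ (≤-<-trans x≤t t<h₁)
        h₂≢ : ∀ {x} → x ≤ t → h₂ ≢ x
        h₂≢ x≤t = >⇒≢ (≤-<-trans x≤t t<h₂)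

    core-alternate : ∀ {a b} → a ≤ t → b ≤ t → Alternate _≟_ core a b ⇔ Alternate _≟_ (pathWord p) a b
    core-alternate a≤t b≤t =
      mk⇔ (subst (Linked _≢_) (core-↾-path a≤t b≤t)) (subst (Linked _≢_) (sym (core-↾-path a≤t b≤t)))

    core-↾-hub₁ : ∀ c → core ↾ h₁ , c ≡ (h₁ ∷ front ↾ h₁ , c ++ h₁ ∷ []) ++ wrap h₂ (fall p) ↾ h₁ , c
    core-↾-hub₁ c =
      trans (↾-++ (wrap h₁ front) (wrap h₂ (fall p)) {h₁} {c})
            (cong (_++ wrap h₂ (fall p) ↾ h₁ , c) (↾-wrap-self h₁ c front))

    core-↾-hub₂ : ∀ {c} → c ≤ t → core ↾ h₂ , c ≡ front ↾ h₂ , c ++ h₂ ∷ fall p ↾ h₂ , c ++ h₂ ∷ []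
    core-↾-hub₂ {c} c≤t =
      trans (↾-++ (wrap h₁ front) (wrap h₂ (fall p)) {h₂} {c})
            (cong₂ _++_ (↾-wrap-other h₂ c front (1+n≢n ∘ sym) (>⇒≢ (≤-<-trans c≤t t<h₁)))
                        (↾-wrap-self h₂ c (fall p)))

    core-↾-hub₁-path : ∀ {c} → 1 ≤ c → c ≤ t → core ↾ h₁ , c ≡ h₁ ∷ c ∷ h₁ ∷ c ∷ []
    core-↾-hub₁-path {c} 1≤c c≤t = begin
      core ↾ h₁ , c                                                     ≡⟨ core-↾-hub₁ c ⟩
      (h₁ ∷ front ↾ h₁ , c ++ h₁ ∷ []) ++ wrap h₂ (fall p) ↾ h₁ , c     ≡⟨ cong ((h₁ ∷ front ↾ h₁ , c ++ h₁ ∷ []) ++_)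
                                                                              (↾-wrap-other h₁ c (fall p) 1+n≢n (>⇒≢ (≤-<-trans c≤t t<h₂))) ⟩
      (h₁ ∷ front ↾ h₁ , c ++ h₁ ∷ []) ++ fall p ↾ h₁ , c               ≡⟨ cong₂ (λ r s → (h₁ ∷ r ++ h₁ ∷ []) ++ s)
                                                                              (front-once t<h₁ 1≤c c≤t) (fall-once p t<h₁ c≤t) ⟩
      h₁ ∷ c ∷ h₁ ∷ c ∷ []                                              ∎

  doubleFanWord-alternate-path : ∀ {a b} → a < b → b < t → Alternate _≟_ (doubleFanWord p) a b ⇔ b ≡ suc a
  doubleFanWord-alternate-path {a} {b} a<b b<t =
    ⇔.trans (mk⇔ (subst (Linked _≢_) top-dropped) (subst (Linked _≢_) (sym top-dropped)))
            (⇔.trans (core-alternate (<⇒≤ (<-trans a<b b<t)) (<⇒≤ b<t)) (pathWord-alternate p a<b (<⇒≤ b<t)))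
    where
      top-dropped : doubleFanWord p ↾ a , b ≡ core ↾ a , b
      top-dropped = ↾-drop a b (>⇒≢ (<-trans a<b b<t)) (>⇒≢ b<t)

  doubleFanWord-alternate-top : 1 ≤ p → ∀ {a} → a < t → Alternate _≟_ (doubleFanWord p) a t ⇔ t ≡ suc a
  doubleFanWord-alternate-top 1≤p {a} a<t = mk⇔
    (Equivalence.to pathWord-a-t ∘ Equivalence.to (core-alternate (<⇒≤ a<t) ≤-refl) ∘ alternate-∷⁻ {t} {core})
    (λ t≡1+a → alternate-∷ (>⇒≢ a<t) (core-↾-starts (positive 1≤p t≡1+a))
                 (Equivalence.from (core-alternate (<⇒≤ a<t) ≤-refl) (Equivalence.from pathWord-a-t t≡1+a)))
    where
      pathWord-a-t : Alternate _≟_ (pathWord p) a t ⇔ t ≡ suc a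
      pathWord-a-t = pathWord-alternate p a<t ≤-refl
      positive : 1 ≤ p → t ≡ suc a → 1 ≤ a
      positive (s≤s z≤n) refl = s≤s z≤n
      core-↾-starts : 1 ≤ a → core ↾ a , t ≡ a ∷ (t ∷ fall p) ↾ a , t
      core-↾-starts 1≤a = begin
        core ↾ a , t                           ≡⟨ core-↾-path (<⇒≤ a<t) ≤-refl ⟩
        pathWord p ↾ a , t                     ≡⟨ ↾-++ (rise p) (t ∷ fall p) ⟩
        rise p ↾ a , t ++ (t ∷ fall p) ↾ a , t ≡⟨ cong (_++ (t ∷ fall p) ↾ a , t) rise-↾ ⟩
        a ∷ (t ∷ fall p) ↾ a , t               ∎
        where
          rise-↾ : rise p ↾ a , t ≡ a ∷ []
          rise-↾ = trans (↾-comm (rise p) a t) (rise-once p ≤-refl 1≤a a<t)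

  doubleFanWord-alternate-hub₁ : ∀ {c} → 1 ≤ c → c ≤ t → Alternate _≟_ (doubleFanWord p) h₁ c
  doubleFanWord-alternate-hub₁ {c} 1≤c c≤t with m≤n⇒m<n∨m≡n c≤t
  ... | inj₁ c<t =
    subst (Linked _≢_) (sym (trans (↾-drop h₁ c (<⇒≢ t<h₁) (>⇒≢ c<t)) (core-↾-hub₁-path 1≤c c≤t)))
          (>⇒≢ c<h₁ ∷ <⇒≢ c<h₁ ∷ >⇒≢ c<h₁ ∷ [-])
    where
      c<h₁ : c < h₁
      c<h₁ = <-trans c<t t<h₁
  ... | inj₂ refl = alternate-∷ (<⇒≢ t<h₁) (core-↾-hub₁-path 1≤c c≤t)
                      (subst (Linked _≢_) (sym (core-↾-hub₁-path 1≤c c≤t)) (1+n≢n ∷ 1+n≢n ∘ sym ∷ 1+n≢n ∷ [-]))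

  doubleFanWord-¬alternate-hub₁-0 : ¬ Alternate _≟_ (doubleFanWord p) h₁ 0
  doubleFanWord-¬alternate-hub₁-0 =
    ↾-repeat⇒¬alternate (doubleFanWord p) h₁ 0 []
      (trans (↾-drop h₁ 0 (<⇒≢ t<h₁) (>⇒≢ (top-positive p)))
      (trans (core-↾-hub₁ 0) (cong (λ r → (h₁ ∷ r ++ h₁ ∷ []) ++ wrap h₂ (fall p) ↾ h₁ , 0) (front-misses-0 t<h₁))))

  doubleFanWord-¬alternate-hubs : ¬ Alternate _≟_ (doubleFanWord p) h₁ h₂
  doubleFanWord-¬alternate-hubs =
    ↾-repeat⇒¬alternate (doubleFanWord p) h₁ h₂ []
      (trans (↾-drop h₁ h₂ (<⇒≢ t<h₁) (<⇒≢ t<h₂))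
      (trans (core-↾-hub₁ h₂) (cong (λ r → (h₁ ∷ r ++ h₁ ∷ []) ++ wrap h₂ (fall p) ↾ h₁ , h₂) front-misses-h₂)))
    where
      front-misses-h₂ : front ↾ h₁ , h₂ ≡ []
      front-misses-h₂ =
        ↾-none h₁ h₂ (All.map (λ (_ , c≤t) → <⇒≢ (≤-<-trans c≤t t<h₁) , <⇒≢ (≤-<-trans c≤t t<h₂)) front-bounded)

  doubleFanWord-alternate-hub₂ : ∀ {c} → c < t → Alternate _≟_ (doubleFanWord p) h₂ c
  doubleFanWord-alternate-hub₂ {c} c<t = subst (Linked _≢_) (sym hub₂-↾) (around c c<t)
    where
      fall-↾ : fall p ↾ h₂ , c ≡ c ∷ []
      fall-↾ = fall-once p t<h₂ (<⇒≤ c<t)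
      hub₂-↾ : doubleFanWord p ↾ h₂ , c ≡ front ↾ h₂ , c ++ h₂ ∷ c ∷ h₂ ∷ []
      hub₂-↾ = begin
        doubleFanWord p ↾ h₂ , c                             ≡⟨ ↾-drop h₂ c (<⇒≢ t<h₂) (>⇒≢ c<t) ⟩
        core ↾ h₂ , c                                        ≡⟨ core-↾-hub₂ (<⇒≤ c<t) ⟩
        front ↾ h₂ , c ++ h₂ ∷ fall p ↾ h₂ , c ++ h₂ ∷ []    ≡⟨ cong (λ r → front ↾ h₂ , c ++ h₂ ∷ r ++ h₂ ∷ []) fall-↾ ⟩
        front ↾ h₂ , c ++ h₂ ∷ c ∷ h₂ ∷ []                   ∎
      around : ∀ c → c < t → Linked _≢_ (front ↾ h₂ , c ++ h₂ ∷ c ∷ h₂ ∷ [])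
      around zero    _     =
        subst (λ r → Linked _≢_ (r ++ h₂ ∷ 0 ∷ h₂ ∷ [])) (sym (front-misses-0 t<h₂)) ((λ ()) ∷ (λ ()) ∷ [-])
      around (suc c) 1+c<t =
        subst (λ r → Linked _≢_ (r ++ h₂ ∷ suc c ∷ h₂ ∷ [])) (sym (front-once t<h₂ (s≤s z≤n) (<⇒≤ 1+c<t)))
              (<⇒≢ 1+c<h₂ ∷ >⇒≢ 1+c<h₂ ∷ <⇒≢ 1+c<h₂ ∷ [-])
        where
          1+c<h₂ : suc c < h₂
          1+c<h₂ = <-trans 1+c<t t<h₂

  doubleFanWord-¬alternate-hub₂-top : ¬ Alternate _≟_ (doubleFanWord p) h₂ t
  doubleFanWord-¬alternate-hub₂-top =
    ↾-repeat⇒¬alternate (doubleFanWord p) h₂ t []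
      (trans (↾-keepʳ h₂ t) (cong (t ∷_) (trans (core-↾-hub₂ ≤-refl) (cong (_++ h₂ ∷ fall p ↾ h₂ , t ++ h₂ ∷ []) front-↾))))
    where
      front-↾ : front ↾ h₂ , t ≡ t ∷ []
      front-↾ = front-once t<h₂ (top-positive p) ≤-refl

doubleFanWord-bounded : ∀ p → All (_≤ 2 + top p) (doubleFanWord p)
doubleFanWord-bounded p =
  m≤n+m t 2 ∷ Allₚ.++⁺ (n≤1+n _ ∷ Allₚ.++⁺ front≤ (n≤1+n _ ∷ [])) (≤-refl ∷ Allₚ.++⁺ fall≤ (≤-refl ∷ []))
  where
    t : ℕ
    t = top p
    front≤ : All (_≤ 2 + t) (rise p ++ t ∷ [])
    front≤ = Allₚ.++⁺ (All.map (λ (_ , x<t) → ≤-trans (<⇒≤ x<t) (m≤n+m t 2)) (rise-bounded p)) (m≤n+m t 2 ∷ [])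
    fall≤ : All (_≤ 2 + t) (fall p)
    fall≤ = All.map (λ x≤t → ≤-trans x≤t (m≤n+m t 2)) (fall-bounded p)

-- For n = p + 1: y is coded 0, the vertex labelled ℓ ∈ [2, 2p+1] is coded ℓ − 1, x is coded
-- 2p+1 = top p and the hubs 1 and 2n are coded 2p+2 and 2p+3: the path y, 2, …, 2n−1, x
-- becomes 0 … top p.
module _ (p : ℕ) where
  private
    t n : ℕ
    t = top p
    n = suc p

    path<2n : ∀ {c} → c < 2 * p → suc c < 2 * n
    path<2n {c} c<2p = subst (suc c <_) (sym (*-suc 2 p)) (s≤s (s≤s (<⇒≤ c<2p)))

    1+2p<2n : suc (2 * p) < 2 * n
    1+2p<2n = subst (suc (2 * p) <_) (sym (*-suc 2 p)) ≤-refl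

  doubleFanCode : VXY (2 * n) → ℕ
  doubleFanCode (num fzero) = suc t
  doubleFanCode (num (fsuc j)) with toℕ j <? 2 * p
  ... | yes _ = suc (toℕ j)
  ... | no _  = 2 + t
  doubleFanCode vx = t
  doubleFanCode vy = 0

  doubleFanVertex : ℕ → VXY (2 * n)
  doubleFanVertex zero = vy
  doubleFanVertex (suc c) with <-cmp c (2 * p)
  ... | tri< c<2p _ _ = num (fromℕ< (path<2n c<2p))
  ... | tri≈ _ _ _    = vx
  ... | tri> _ _ _ with c ≟ suc (2 * p)
  ...   | yes _ = num fzero
  ...   | no _  = num (fromℕ< 1+2p<2n)

  toℕ≤1+2p : ∀ (i : Fin (2 * n)) → toℕ i ≤ suc (2 * p)
  toℕ≤1+2p i = ≤-pred (subst (toℕ i <_) (*-suc 2 p) (Finₚ.toℕ<n i))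

  doubleFanCode-path : ∀ {j} → toℕ j < 2 * p → doubleFanCode (num (fsuc j)) ≡ suc (toℕ j)
  doubleFanCode-path {j} j<2p with toℕ j <? 2 * p
  ... | yes _    = refl
  ... | no j≮2p = ⊥-elim (j≮2p j<2p)

  doubleFanCode-hub₂ : ∀ {j} → toℕ j ≡ 2 * p → doubleFanCode (num (fsuc j)) ≡ 2 + t
  doubleFanCode-hub₂ {j} j≡2p with toℕ j <? 2 * p
  ... | yes j<2p = ⊥-elim (<-irrefl j≡2p j<2p)
  ... | no _     = refl

  doubleFanVertex-code : ∀ v → doubleFanVertex (doubleFanCode v) ≡ v
  doubleFanVertex-code (num fzero) rewrite top≡ p with <-cmp (suc (2 * p)) (2 * p)
  ... | tri< 1+2p<2p _ _ = ⊥-elim (<-asym 1+2p<2p (n<1+n _))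
  ... | tri≈ _ 1+2p≡2p _ = ⊥-elim (1+n≢n 1+2p≡2p)
  ... | tri> _ _ _ with suc (2 * p) ≟ suc (2 * p)
  ...   | yes _   = refl
  ...   | no 1+2p≢1+2p = ⊥-elim (1+2p≢1+2p refl)
  doubleFanVertex-code (num (fsuc j)) with toℕ j <? 2 * p
  ... | yes j<2p with <-cmp (toℕ j) (2 * p)
  ...   | tri< _ _ _     = cong num (Finₚ.fromℕ<-toℕ (fsuc j) (Finₚ.toℕ<n (fsuc j)))
  ...   | tri≈ j≮2p _ _ = ⊥-elim (j≮2p j<2p)
  ...   | tri> j≮2p _ _ = ⊥-elim (j≮2p j<2p)
  doubleFanVertex-code (num (fsuc j)) | no j≮2p rewrite top≡ p with <-cmp (2 + 2 * p) (2 * p)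
  ... | tri< 2+2p<2p _ _ = ⊥-elim (<-asym 2+2p<2p (≤-trans (n<1+n _) (n≤1+n _)))
  ... | tri≈ _ 2+2p≡2p _ = ⊥-elim (<⇒≢ (≤-trans (n<1+n _) (n≤1+n _)) (sym 2+2p≡2p))
  ... | tri> _ _ _ with 2 + 2 * p ≟ suc (2 * p)
  ...   | yes 2+2p≡1+2p = ⊥-elim (1+n≢n 2+2p≡1+2p)
  ...   | no _ = cong num (Finₚ.toℕ-injective (trans (Finₚ.toℕ-fromℕ< 1+2p<2n) (cong suc (sym j≡2p))))
    where
      j≡2p : toℕ j ≡ 2 * p
      j≡2p = ≤-antisym (≤-pred (toℕ≤1+2p (fsuc j))) (≮⇒≥ j≮2p)
  doubleFanVertex-code vx rewrite top≡ p with <-cmp (2 * p) (2 * p)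
  ... | tri< 2p<2p _ _ = ⊥-elim (<-irrefl refl 2p<2p)
  ... | tri≈ _ _ _     = refl
  ... | tri> _ _ 2p<2p = ⊥-elim (<-irrefl refl 2p<2p)
  doubleFanVertex-code vy = refl

  doubleFanCode-vertex : ∀ {c} → c ≤ 2 + t → doubleFanCode (doubleFanVertex c) ≡ c
  doubleFanCode-vertex {zero} _ = refl
  doubleFanCode-vertex {suc c} 1+c≤2+t with <-cmp c (2 * p)
  ... | tri< c<2p _ _ = trans (doubleFanCode-path (subst (_< 2 * p) (sym c≡) c<2p)) (cong suc c≡)
    where
      c≡ : toℕ (fromℕ< (s<s⁻¹ (path<2n c<2p))) ≡ c
      c≡ = Finₚ.toℕ-fromℕ< (s<s⁻¹ (path<2n c<2p))
  ... | tri≈ _ refl _ = top≡ p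
  ... | tri> _ _ 2p<c with c ≟ suc (2 * p)
  ...   | yes refl = cong suc (top≡ p)
  ...   | no c≢1+2p =
    trans (doubleFanCode-hub₂ (Finₚ.toℕ-fromℕ< (s<s⁻¹ 1+2p<2n))) (trans (cong (2 +_) (top≡ p)) (cong suc c≡))
    where
      c≡ : 2 + 2 * p ≡ c
      c≡ = ≤-antisym (≤∧≢⇒< 2p<c (c≢1+2p ∘ sym)) (subst (c ≤_) (cong suc (top≡ p)) (≤-pred 1+c≤2+t))

module _ (p : ℕ) (1≤p : 1 ≤ p) where
  private
    t : ℕ
    t = top p
    n : ℕ
    n = suc p
    w : List ℕ
    w = doubleFanWord p
    PR : VXY (2 * n) → VXY (2 * n) → Set
    PR = PairRepresented (G3Base n) (doubleFanCode p) w
    PR-sym : ∀ u v → PR u v → PR v u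
    PR-sym = pairRepresented-sym (G3Base n) (doubleFanCode p) w
    via : ∀ u v {a b} → doubleFanCode p u ≡ a → doubleFanCode p v ≡ b →
          SymClos (G3Base n) u v ⇔ Alternate _≟_ w a b → PR u v
    via = pairRepresented-via-codes (G3Base n) (doubleFanCode p) w

    2n≡ : 2 * n ≡ 2 + 2 * p
    2n≡ = *-suc 2 p

    2n∸1≡ : 2 * n ∸ 1 ≡ suc (2 * p)
    2n∸1≡ = cong (_∸ 1) 2n≡

    2n∸2≡ : 2 * n ∸ 2 ≡ 2 * p
    2n∸2≡ = cong (_∸ 2) 2n≡

    1≢2n : 1 ≢ 2 * n
    1≢2n 1≡2n with trans 1≡2n 2n≡
    ... | ()

    path-or-hub₂ : ∀ j → toℕ j < 2 * p ⊎ toℕ j ≡ 2 * p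
    path-or-hub₂ j = m≤n⇒m<n∨m≡n (≤-pred (toℕ≤1+2p p (fsuc j)))

    path<t : ∀ {c} → c < 2 * p → suc c < t
    path<t {c} c<2p = subst (suc c <_) (sym (top≡ p)) (s≤s c<2p)

    path-label≤ : ∀ {c} → c < 2 * p → 2 + c ≤ 2 * n ∸ 1
    path-label≤ {c} c<2p = subst (2 + c ≤_) (sym 2n∸1≡) (s≤s c<2p)

    hub₂-label : ∀ {j : Fin (2 * n ∸ 1)} → toℕ j ≡ 2 * p → 2 + toℕ j ≡ 2 * n
    hub₂-label j≡2p = trans (cong (2 +_) j≡2p) (sym 2n≡)

    hub₁-path : ∀ j → toℕ j < 2 * p → PR (num fzero) (num (fsuc j))
    hub₁-path j j<2p = via (num fzero) (num (fsuc j)) refl (doubleFanCode-path p j<2p)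
      (both (inj₁ (inj₂ (inj₁ (refl , s≤s (s≤s z≤n) , path-label≤ j<2p))))
            (doubleFanWord-alternate-hub₁ p (s≤s z≤n) (<⇒≤ (path<t j<2p))))

    hub₁-hub₂ : ∀ j → toℕ j ≡ 2 * p → PR (num fzero) (num (fsuc j))
    hub₁-hub₂ j j≡2p = via (num fzero) (num (fsuc j)) refl (doubleFanCode-hub₂ p j≡2p)
      (neither no-edge (doubleFanWord-¬alternate-hubs p))
      where
        no-edge : ¬ SymClos (G3Base n) (num fzero) (num (fsuc j))
        no-edge (inj₁ (inj₁ (s≤s () , _)))
        no-edge (inj₁ (inj₂ (inj₁ (_ , _ , 2+j≤2n∸1)))) = 1+n≰n (subst₂ _≤_ (cong (2 +_) j≡2p) 2n∸1≡ 2+j≤2n∸1)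
        no-edge (inj₁ (inj₂ (inj₂ (1≡2n , _)))) = 1≢2n 1≡2n
        no-edge (inj₂ (inj₁ (_ , _ , ())))
        no-edge (inj₂ (inj₂ (inj₁ (() , _))))
        no-edge (inj₂ (inj₂ (inj₂ (_ , s≤s () , _))))

    hub₁-x : PR (num fzero) vx
    hub₁-x = both (inj₁ (inj₁ refl)) (doubleFanWord-alternate-hub₁ p (top-positive p) ≤-refl)

    hub₁-y : PR (num fzero) vy
    hub₁-y = neither (λ { (inj₁ (inj₁ ())) ; (inj₁ (inj₂ 1≡2n)) → 1≢2n 1≡2n ; (inj₂ ()) })
                     (doubleFanWord-¬alternate-hub₁-0 p)

    path-path : ∀ i j → toℕ i < 2 * p → toℕ j < 2 * p → toℕ i < toℕ j → PR (num (fsuc i)) (num (fsuc j))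
    path-path i j i<2p j<2p i<j = via (num (fsuc i)) (num (fsuc j)) (doubleFanCode-path p i<2p) (doubleFanCode-path p j<2p)
      (⇔.trans (mk⇔ to from) (⇔.sym (doubleFanWord-alternate-path p (s≤s i<j) (path<t j<2p))))
      where
        to : SymClos (G3Base n) (num (fsuc i)) (num (fsuc j)) → suc (toℕ j) ≡ suc (suc (toℕ i))
        to (inj₁ (inj₁ (_ , _ , j≡1+i)))         = suc-injective j≡1+i
        to (inj₁ (inj₂ (inj₁ (() , _))))
        to (inj₁ (inj₂ (inj₂ (i≡2n , _))))       = ⊥-elim (<⇒≢ i<2p (suc-injective (suc-injective (trans i≡2n 2n≡))))
        to (inj₂ (inj₁ (_ , _ , i≡1+j)))         =
          ⊥-elim (<-asym i<j (subst (toℕ j <_) (sym (suc-injective (suc-injective i≡1+j))) (n<1+n _)))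
        to (inj₂ (inj₂ (inj₁ (() , _))))
        to (inj₂ (inj₂ (inj₂ (j≡2n , _))))       = ⊥-elim (<⇒≢ j<2p (suc-injective (suc-injective (trans j≡2n 2n≡))))
        from : suc (toℕ j) ≡ suc (suc (toℕ i)) → SymClos (G3Base n) (num (fsuc i)) (num (fsuc j))
        from j≡1+i = inj₁ (inj₁ (s≤s (s≤s z≤n) , subst₂ _≤_ j≡1+i (sym 2n∸2≡) j<2p , cong suc j≡1+i))

    hub₂-path : ∀ i j → toℕ i ≡ 2 * p → toℕ j < 2 * p → PR (num (fsuc i)) (num (fsuc j))
    hub₂-path i j i≡2p j<2p = via (num (fsuc i)) (num (fsuc j)) (doubleFanCode-hub₂ p i≡2p) (doubleFanCode-path p j<2p)
      (both (inj₁ (inj₂ (inj₂ (hub₂-label i≡2p , s≤s (s≤s z≤n) , path-label≤ j<2p))))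
            (doubleFanWord-alternate-hub₂ p (path<t j<2p)))

    path-x : ∀ j → toℕ j < 2 * p → PR (num (fsuc j)) vx
    path-x j j<2p = via (num (fsuc j)) vx (doubleFanCode-path p j<2p) refl
      (⇔.trans (mk⇔ to from) (⇔.sym (doubleFanWord-alternate-top p 1≤p (path<t j<2p))))
      where
        to : SymClos (G3Base n) (num (fsuc j)) vx → t ≡ suc (suc (toℕ j))
        to (inj₁ (inj₁ ()))
        to (inj₁ (inj₂ j≡2n∸1)) = trans (top≡ p) (sym (trans j≡2n∸1 2n∸1≡))
        to (inj₂ ())
        from : t ≡ suc (suc (toℕ j)) → SymClos (G3Base n) (num (fsuc j)) vx
        from t≡2+j = inj₁ (inj₂ (trans (sym t≡2+j) (trans (top≡ p) (sym 2n∸1≡))))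

    hub₂-x : ∀ j → toℕ j ≡ 2 * p → PR (num (fsuc j)) vx
    hub₂-x j j≡2p = via (num (fsuc j)) vx (doubleFanCode-hub₂ p j≡2p) refl (neither no-edge (doubleFanWord-¬alternate-hub₂-top p))
      where
        no-edge : ¬ SymClos (G3Base n) (num (fsuc j)) vx
        no-edge (inj₁ (inj₁ ()))
        no-edge (inj₁ (inj₂ j≡2n∸1)) = 1+n≢n (trans (cong (2 +_) (sym j≡2p)) (trans j≡2n∸1 2n∸1≡))
        no-edge (inj₂ ())

    y-path : ∀ j → toℕ j < 2 * p → PR vy (num (fsuc j))
    y-path j j<2p = via vy (num (fsuc j)) refl (doubleFanCode-path p j<2p)
      (⇔.trans (mk⇔ to from) (⇔.sym (doubleFanWord-alternate-path p (s≤s z≤n) (path<t j<2p))))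
      where
        to : SymClos (G3Base n) vy (num (fsuc j)) → suc (toℕ j) ≡ 1
        to (inj₁ ())
        to (inj₂ (inj₁ j≡0))  = suc-injective j≡0
        to (inj₂ (inj₂ j≡2n)) = ⊥-elim (<⇒≢ j<2p (suc-injective (suc-injective (trans j≡2n 2n≡))))
        from : suc (toℕ j) ≡ 1 → SymClos (G3Base n) vy (num (fsuc j))
        from j≡0 = inj₂ (inj₁ (cong suc j≡0))

    hub₂-y : ∀ j → toℕ j ≡ 2 * p → PR (num (fsuc j)) vy
    hub₂-y j j≡2p = via (num (fsuc j)) vy (doubleFanCode-hub₂ p j≡2p) refl
      (both (inj₁ (inj₂ (hub₂-label j≡2p))) (doubleFanWord-alternate-hub₂ p (top-positive p)))

    y-x : PR vy vx
    y-x = neither (λ { (inj₁ ()) ; (inj₂ ()) }) (top≢1 1≤p ∘ Equivalence.to (doubleFanWord-alternate-top p 1≤p (top-positive p)))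

    hub₁-succ : ∀ j → PR (num fzero) (num (fsuc j))
    hub₁-succ j with path-or-hub₂ j
    ... | inj₁ j<2p = hub₁-path j j<2p
    ... | inj₂ j≡2p = hub₁-hub₂ j j≡2p

    succ-x : ∀ j → PR (num (fsuc j)) vx
    succ-x j with path-or-hub₂ j
    ... | inj₁ j<2p = path-x j j<2p
    ... | inj₂ j≡2p = hub₂-x j j≡2p

    y-succ : ∀ j → PR vy (num (fsuc j))
    y-succ j with path-or-hub₂ j
    ... | inj₁ j<2p = y-path j j<2p
    ... | inj₂ j≡2p = PR-sym (num (fsuc j)) vy (hub₂-y j j≡2p)

    succ-succ : ∀ i j → i ≢ j → PR (num (fsuc i)) (num (fsuc j))
    succ-succ i j i≢j with path-or-hub₂ i | path-or-hub₂ j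
    ... | inj₁ i<2p | inj₁ j<2p =
      pairRepresented-by-order (G3Base n) (doubleFanCode p) w (num ∘ fsuc ∘ proj₁) (toℕ ∘ proj₁)
        (λ (i , i<2p) (j , j<2p) → path-path i j i<2p j<2p) (i , i<2p) (j , j<2p) (i≢j ∘ Finₚ.toℕ-injective)
    ... | inj₁ i<2p | inj₂ j≡2p = PR-sym (num (fsuc j)) (num (fsuc i)) (hub₂-path j i j≡2p i<2p)
    ... | inj₂ i≡2p | inj₁ j<2p = hub₂-path i j i≡2p j<2p
    ... | inj₂ i≡2p | inj₂ j≡2p = ⊥-elim (i≢j (Finₚ.toℕ-injective (trans i≡2p (sym j≡2p))))

  doubleFan-pairs : ∀ u v → u ≢ v → PR u v
  doubleFan-pairs (num fzero)    (num fzero)    u≢v = ⊥-elim (u≢v refl)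
  doubleFan-pairs (num fzero)    (num (fsuc j)) _   = hub₁-succ j
  doubleFan-pairs (num fzero)    vx             _   = hub₁-x
  doubleFan-pairs (num fzero)    vy             _   = hub₁-y
  doubleFan-pairs (num (fsuc i)) (num fzero)    _   = PR-sym (num fzero) (num (fsuc i)) (hub₁-succ i)
  doubleFan-pairs (num (fsuc i)) (num (fsuc j)) u≢v = succ-succ i j (u≢v ∘ cong (num ∘ fsuc))
  doubleFan-pairs (num (fsuc i)) vx             _   = succ-x i
  doubleFan-pairs (num (fsuc i)) vy             _   = PR-sym vy (num (fsuc i)) (y-succ i)
  doubleFan-pairs vx             (num fzero)    _   = PR-sym (num fzero) vx hub₁-x
  doubleFan-pairs vx             (num (fsuc j)) _   = PR-sym (num (fsuc j)) vx (succ-x j)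
  doubleFan-pairs vx             vx             u≢v = ⊥-elim (u≢v refl)
  doubleFan-pairs vx             vy             _   = PR-sym vy vx y-x
  doubleFan-pairs vy             (num fzero)    _   = PR-sym (num fzero) vy hub₁-y
  doubleFan-pairs vy             (num (fsuc j)) _   = y-succ j
  doubleFan-pairs vy             vx             _   = y-x
  doubleFan-pairs vy             vy             u≢v = ⊥-elim (u≢v refl)

doubleFan-representable : ∀ p → 1 ≤ p → WordRepresentable (G3 (suc p))
doubleFan-representable p 1≤p =
  mkGraph-representable (VXY-≟ _) (G3Base (suc p)) (doubleFanCode p) (doubleFanVertex p) (doubleFanVertex-code p) (doubleFanWord p)
    (All.map (doubleFanCode-vertex p) (doubleFanWord-bounded p)) (doubleFan-pairs p 1≤p)

corollary1 : (∀ (n : ℕ) → 2 ≤ n → WordRepresentable (G1 n))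
    × (∀ (n : ℕ) → 2 ≤ n → WordRepresentable (G2 n))
    × (∀ (n : ℕ) → 3 ≤ n → WordRepresentable (G3 n))
corollary1 =
  (λ n _ → cycle-representable n) ,
  (λ n 2≤n → fan-representable n (≤-trans (s≤s z≤n) 2≤n)) ,
  double-fan
  where
    double-fan : ∀ n → 3 ≤ n → WordRepresentable (G3 n)
    double-fan (suc p) (s≤s 2≤p) = doubleFan-representable p (≤-trans (s≤s z≤n) 2≤p)
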